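{- For all integers $v\ge4$ and $d\ge1$, \[\sum_{D\in\mathcal{D}_{v,d}(132)} w^{rlmax(\pi_D)}x^{des(\pi_D)}y^{d}z^{lis(\pi_D)} = \sum_{p\in Dyck_{v,d}} w^{touchpoints(p)}x^{corners(p)}y^{d}z^{height(p)}.\]
   Context: A diamond with $v$ vertices ($v\ge4$) is the poset with a least element, a greatest element, and $v-2$ pairwise incomparable middle elements (in a fixed left-to-right order) strictly between them. $\mathcal{D}_{v,d}$ is the set of labellings of $d$ diamonds (placed left to right) by $1,\dots,vd$, each label used once, such that in each diamond least label $<$ each middle label $<$ greatest label. For $D\in\mathcal{D}_{v,d}$, $\pi_D$ is the permutation obtained by reading the diamonds left to right and, within each diamond, the least element, then the middle elements left to right, then the greatest element. $\mathcal{D}_{v,d}(132)$ is the set of $D$ with $\pi_D$ avoiding the classical pattern $132$. For a permutation $\pi$: $des(\pi)$ is the number of $i$ with $\pi_i>\pi_{i+1}$; $lis(\pi)$ is the length of a longest increasing subsequence; $rlmax(\pi)$ is the number of right-to-left maxima (entries larger than all entries to their right). $Dyck_{v,d}$ is the set of lattice paths from $(0,0)$ to $(d,vd)$ with steps $(1,0)$ (East) and $(0,1)$ (North) staying weakly below the line $y=vx$. For $p\in Dyck_{v,d}$: $touchpoints(p)$ is the number of points of $p$ lying on the line $y=vx$, excluding the endpoint $(d,vd)$; $corners(p)$ is the number of North steps of $p$ immediately followed by an East step; $height(p)$ is the greatest vertical distance from a point of $p$ to the line $y=vx$, i.e. the maximum of $vx-y$ over points $(x,y)$ of $p$. -}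

module Defs where

open import Data.Nat using (ℕ; zero; suc; _+_; _*_; _∸_; _⊔_; _<ᵇ_; _≡ᵇ_; _≤ᵇ_)
open import Data.Bool using (Bool; true; false; _∧_; _∨_; not; if_then_else_)
open import Data.List using (List; []; _∷_; _++_; map; concatMap; filter; length; upTo; take; drop; foldr)
open import Data.Product using (_×_; _,_)
open import Data.Maybe using (Maybe; just; nothing)
open import Relation.Nullary.Decidable using (Dec; yes; no)
open import Data.Bool using (T)
open import Relation.Unary using (Pred; Decidable)
open import Data.Bool.Properties using (T?)

countᵇ : {A : Set} → (A → Bool) → List A → ℕ
countᵇ p []       = 0
countᵇ p (x ∷ xs) = (if p x then 1 else 0) + countᵇ p xs

allᵇ : {A : Set} → (A → Bool) → List A → Bool
allᵇ p []       = true
allᵇ p (x ∷ xs) = p x ∧ allᵇ p xs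

anyᵇ : {A : Set} → (A → Bool) → List A → Bool
anyᵇ p []       = false
anyᵇ p (x ∷ xs) = p x ∨ anyᵇ p xs

maxList : List ℕ → ℕ
maxList = foldr _⊔_ 0

insertAll : ℕ → List ℕ → List (List ℕ)
insertAll x []       = (x ∷ []) ∷ []
insertAll x (y ∷ ys) = (x ∷ y ∷ ys) ∷ map (y ∷_) (insertAll x ys)

permutations : List ℕ → List (List ℕ)
permutations []       = [] ∷ []
permutations (x ∷ xs) = concatMap (insertAll x) (permutations xs)

labels : ℕ → List ℕ
labels n = map suc (upTo n)

des : List ℕ → ℕ
des []           = 0
des (a ∷ [])     = 0
des (a ∷ b ∷ xs) = (if b <ᵇ a then 1 else 0) + des (b ∷ xs)

lisAbove : ℕ → List ℕ → ℕ
lisAbove b []       = 0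
lisAbove b (x ∷ xs) =
  if b <ᵇ x then (suc (lisAbove x xs) ⊔ lisAbove b xs) else lisAbove b xs

lis : List ℕ → ℕ
lis []       = 0
lis (x ∷ xs) = suc (lisAbove x xs) ⊔ lis xs

rlmax : List ℕ → ℕ
rlmax []       = 0
rlmax (x ∷ xs) = (if allᵇ (λ y → y <ᵇ x) xs then 1 else 0) + rlmax xs

has21Above : ℕ → List ℕ → Bool
has21Above a []       = false
has21Above a (b ∷ xs) =
  ((a <ᵇ b) ∧ anyᵇ (λ c → (a <ᵇ c) ∧ (c <ᵇ b)) xs) ∨ has21Above a xs

avoids132 : List ℕ → Bool
avoids132 []       = true
avoids132 (a ∷ xs) = not (has21Above a xs) ∧ avoids132 xs

splitLast : List ℕ → Maybe (List ℕ × ℕ)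
splitLast []       = nothing
splitLast (x ∷ xs) with splitLast xs
... | nothing        = just ([] , x)
... | just (ms , g)  = just (x ∷ ms , g)

-- one diamond read as: least, middles (left to right), greatest;
-- condition: least < each middle < greatest
diamondOK : List ℕ → Bool
diamondOK []       = false
diamondOK (l ∷ rest) with splitLast rest
... | nothing       = false
... | just (ms , g) = allᵇ (λ m → (l <ᵇ m) ∧ (m <ᵇ g)) ms

diamondsOK : ℕ → ℕ → List ℕ → Bool
diamondsOK v zero    π = length π ≡ᵇ 0
diamondsOK v (suc d) π = diamondOK (take v π) ∧ diamondsOK v d (drop v π)

-- A labelling D ∈ 𝒟_{v,d} is determined by (and identified with) its reading
-- word π_D, a permutation of 1..vd whose consecutive blocks of length v
-- satisfy the diamond order conditions.
diamonds132 : ℕ → ℕ → List (List ℕ)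
diamonds132 v d =
  filter (λ π → T? (diamondsOK v d π ∧ avoids132 π)) (permutations (labels (v * d)))

data Step : Set where
  E N : Step   -- E = (1,0), N = (0,1)

words : ℕ → ℕ → List (List Step)
words zero    zero    = [] ∷ []
words (suc e) zero    = map (E ∷_) (words e zero)
words zero    (suc n) = map (N ∷_) (words zero n)
words (suc e) (suc n) = map (E ∷_) (words e (suc n)) ++ map (N ∷_) (words (suc e) n)

pointsBefore : ℕ × ℕ → List Step → List (ℕ × ℕ)
pointsBefore p            []      = []
pointsBefore (x , y) (E ∷ s) = (x , y) ∷ pointsBefore (suc x , y) s
pointsBefore (x , y) (N ∷ s) = (x , y) ∷ pointsBefore (x , suc y) s

endPoint : ℕ × ℕ → List Step → ℕ × ℕ
endPoint p            []      = p
endPoint (x , y) (E ∷ s) = endPoint (suc x , y) s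
endPoint (x , y) (N ∷ s) = endPoint (x , suc y) s

points : List Step → List (ℕ × ℕ)
points s = pointsBefore (0 , 0) s ++ (endPoint (0 , 0) s ∷ [])

weaklyBelow : ℕ → List Step → Bool
weaklyBelow v s = allᵇ (λ { (x , y) → y ≤ᵇ v * x }) (points s)

dyckPaths : ℕ → ℕ → List (List Step)
dyckPaths v d = filter (λ s → T? (weaklyBelow v s)) (words d (v * d))

touchpoints : ℕ → List Step → ℕ
touchpoints v s = countᵇ (λ { (x , y) → y ≡ᵇ v * x }) (pointsBefore (0 , 0) s)

corners : List Step → ℕ
corners []           = 0
corners (E ∷ s)      = corners s
corners (N ∷ [])     = 0
corners (N ∷ E ∷ s)  = suc (corners (E ∷ s))
corners (N ∷ N ∷ s)  = corners (N ∷ s)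

height : ℕ → List Step → ℕ
height v s = maxList (map (λ { (x , y) → v * x ∸ y }) (points s))

-- Polynomials in w, x, y, z with ℕ coefficients, represented as multisets
-- (lists) of monomials w^a x^b y^c z^e ↦ (a , b , c , e).

Monomial : Set
Monomial = ℕ × ℕ × ℕ × ℕ

_≡ᵐ_ : Monomial → Monomial → Bool
(a , b , c , e) ≡ᵐ (a' , b' , c' , e') = (a ≡ᵇ a') ∧ (b ≡ᵇ b') ∧ (c ≡ᵇ c') ∧ (e ≡ᵇ e')

coeff : List Monomial → Monomial → ℕ
coeff P m = countᵇ (λ m' → m' ≡ᵐ m) P

diamondPoly : ℕ → ℕ → List Monomial
diamondPoly v d = map (λ π → rlmax π , des π , d , lis π) (diamonds132 v d)

dyckPoly : ℕ → ℕ → List Monomial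
dyckPoly v d = map (λ p → touchpoints v p , corners p , d , height v p) (dyckPaths v d)

module Submission where

-- A 132-avoiding permutation splits at its maximum n + 1 as (a shifted up by c) (n + 1) b, where a
-- and b are 132-avoiding permutations of sizes q and c with q + c = n.  For a 132-avoider whose
-- diamonds have a middle element, the diamond conditions say exactly that the word
-- increases inside every block of v positions; in the split this forces the maximum to end a block
-- unless b is empty.  Dually, a path weakly below y = v x splits at its last return to the line into
-- b followed by an excursion E a N (or, if it never returns, ends with a north step after a), and this
-- is the same recursion over the same admissible pairs (q , c).  Along both recursions the statistics
-- (rlmax, des, lis) and (touchpoints, corners, height) obey the same rule, so the two families have
-- the same multiset of statistics.

open import Defs
open import Data.Bool using (Bool; true; false; _∧_; _∨_; not; if_then_else_)
open import Data.Bool.Properties using (T?; T-≡; ∧-assoc; ∧-zeroʳ; ∨-zeroʳ; ∨-identityʳ; ∨-assoc)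
open import Data.Empty using (⊥; ⊥-elim)
open import Data.List using (List; []; _∷_; _++_; [_]; map; concat; concatMap; cartesianProductWith; filter; length; applyUpTo; take; drop)
open import Data.List.Properties
  using (∷-injective; ∷-injectiveʳ; ++-assoc; ++-identityʳ; ++-cancelˡ; ∷ʳ-injectiveˡ; length-++; length-map;
         length-take; length-drop; take++drop≡id; map-++; map-∘; map-id; map-upTo; map-injective; map-cong; map-cong-local; map-concatMap)
open import Data.List.Membership.Propositional using (_∈_; _∉_; find; lose)
open import Data.List.Membership.Propositional.Properties
  using (∈-map⁺; ∈-map⁻; ∈-++⁺ˡ; ∈-++⁺ʳ; ∈-++⁻; ∈-concatMap⁺; ∈-concatMap⁻; ∈-filter⁺; ∈-filter⁻; ∈-∃++;
         ∈-cartesianProductWith⁻; ∈-cartesianProductWith⁺)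
open import Data.List.Membership.Propositional.Properties.WithK using (unique∧set⇒bag)
open import Data.List.Relation.Unary.Any using (here; there)
open import Data.List.Relation.Unary.All using (All; []; _∷_)
import Data.List.Relation.Unary.All as Allₚ
open import Data.List.Relation.Unary.All.Properties using () renaming (++⁺ to All-++⁺)
open import Data.List.Relation.Unary.AllPairs using ([]; _∷_)
open import Data.List.Relation.Unary.Unique.Propositional using (Unique)
import Data.List.Relation.Unary.Unique.Propositional.Properties as Uniqueₚ
open import Data.List.Relation.Binary.BagAndSetEquality using (∼bag⇒↭)
open import Data.List.Relation.Binary.Permutation.Propositional using (_↭_; ↭-sym; ↭-refl; ↭-trans)
import Data.List.Relation.Binary.Permutation.Propositional as ↭
open import Data.List.Relation.Binary.Permutation.Propositional.Properties
  using (∈-resp-↭; drop-mid; shift; ↭-length; ↭-empty-inv; All-resp-↭)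
  renaming (map⁺ to ↭-map⁺; ++⁺ to ↭-++⁺; ++⁺ʳ to ↭-++⁺ʳ; ++-comm to ↭-++-comm)
open import Data.Maybe using (Maybe; just; nothing)
open import Data.Maybe.Properties using (just-injective)
open import Data.Nat using (ℕ; zero; suc; pred; _+_; _*_; _∸_; _⊔_; _≤_; _<_; z≤n; s≤s; _<ᵇ_; _≡ᵇ_; _≤ᵇ_)
open import Data.Nat.Properties
open import Data.Product using (_×_; _,_; proj₁; proj₂; ∃; ∃₂; map₁)
open import Data.Sum using (_⊎_; inj₁; inj₂; map₂)
open import Function.Bundles using (Equivalence; mk⇔)
open import Relation.Binary.Definitions using (tri<; tri≈; tri>)
open import Relation.Binary.PropositionalEquality using (_≡_; _≢_; refl; cong; cong₂; sym; trans; subst; subst₂; module ≡-Reasoning)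
open import Function using (_∘_)
open import Relation.Nullary using (yes; no)

<ᵇ-true : {m n : ℕ} → m < n → (m <ᵇ n) ≡ true
<ᵇ-true {zero} {suc n} p = refl
<ᵇ-true {suc m} {suc n} (s≤s p) = <ᵇ-true p

<ᵇ-false : {m n : ℕ} → n ≤ m → (m <ᵇ n) ≡ false
<ᵇ-false {m} {zero} p = refl
<ᵇ-false {suc m} {suc n} (s≤s p) = <ᵇ-false p

<ᵇ-sound : {m n : ℕ} → (m <ᵇ n) ≡ true → m < n
<ᵇ-sound {zero} {suc n} p = s≤s z≤n
<ᵇ-sound {suc m} {suc n} p = s≤s (<ᵇ-sound p)

<ᵇ-shift : (c x y : ℕ) → ((c + x) <ᵇ (c + y)) ≡ (x <ᵇ y)
<ᵇ-shift zero x y = refl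
<ᵇ-shift (suc c) x y = <ᵇ-shift c x y

≡ᵇ-refl : (n : ℕ) → (n ≡ᵇ n) ≡ true
≡ᵇ-refl zero = refl
≡ᵇ-refl (suc n) = ≡ᵇ-refl n

≡ᵇ-sound : {m n : ℕ} → (m ≡ᵇ n) ≡ true → m ≡ n
≡ᵇ-sound {zero} {zero} p = refl
≡ᵇ-sound {suc m} {suc n} p = cong suc (≡ᵇ-sound p)

≡ᵇ-false : {m n : ℕ} → m ≢ n → (m ≡ᵇ n) ≡ false
≡ᵇ-false {zero} {zero} p = ⊥-elim (p refl)
≡ᵇ-false {zero} {suc n} p = refl
≡ᵇ-false {suc m} {zero} p = refl
≡ᵇ-false {suc m} {suc n} p = ≡ᵇ-false (λ e → p (cong suc e))

∧-true : {a b : Bool} → (a ∧ b) ≡ true → a ≡ true × b ≡ true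
∧-true {true} {true} p = refl , refl

∨-true : {a b : Bool} → (a ∨ b) ≡ true → a ≡ true ⊎ b ≡ true
∨-true {true} p = inj₁ refl
∨-true {false} {true} p = inj₂ refl

∨-false : {a b : Bool} → (a ∨ b) ≡ false → a ≡ false × b ≡ false
∨-false {false} {false} _ = refl , refl

∧-false-right : {a b : Bool} → a ≡ true → (a ∧ b) ≡ false → b ≡ false
∧-false-right refl e = e

∨-introˡ : {b c : Bool} → b ≡ true → (b ∨ c) ≡ true
∨-introˡ refl = refl

∧-intro : {b c : Bool} → b ≡ true → c ≡ true → (b ∧ c) ≡ true
∧-intro refl refl = refl

not-true : {b : Bool} → not b ≡ true → b ≡ false
not-true {false} p = refl

true≢false : true ≢ false
true≢false ()

bool-ext : {a b : Bool} → (a ≡ true → b ≡ true) → (b ≡ true → a ≡ true) → a ≡ b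
bool-ext {false} {false} f g = refl
bool-ext {false} {true} f g = g refl
bool-ext {true} {false} f g = sym (f refl)
bool-ext {true} {true} f g = refl

≤ᵇ-true : {m n : ℕ} → m ≤ n → (m ≤ᵇ n) ≡ true
≤ᵇ-true p = Equivalence.to T-≡ (≤⇒≤ᵇ p)

≤ᵇ-sound : {m n : ℕ} → (m ≤ᵇ n) ≡ true → m ≤ n
≤ᵇ-sound {m} {n} p = ≤ᵇ⇒≤ m n (Equivalence.from T-≡ p)

≡ᵇ-slack : (y m : ℕ) → y ≤ m → (y ≡ᵇ m) ≡ ((m ∸ y) ≡ᵇ 0)
≡ᵇ-slack zero zero _ = refl
≡ᵇ-slack zero (suc m) _ = refl
≡ᵇ-slack (suc y) (suc m) (s≤s p) = ≡ᵇ-slack y m p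

unique-++⁻ʳ : {A : Set} (xs : List A) {ys : List A} → Unique (xs ++ ys) → Unique ys
unique-++⁻ʳ [] u = u
unique-++⁻ʳ (x ∷ xs) (_ ∷ u) = unique-++⁻ʳ xs u

unique-++⁻ˡ : {A : Set} (xs : List A) {ys : List A} → Unique (xs ++ ys) → Unique xs
unique-++⁻ˡ [] u = []
unique-++⁻ˡ (x ∷ xs) (p ∷ u) = Allₚ.tabulate (λ m → Allₚ.lookup p (∈-++⁺ˡ m)) ∷ unique-++⁻ˡ xs u

unique-++-disjoint : {A : Set} (xs : List A) {ys : List A} → Unique (xs ++ ys) →
  {x y : A} → x ∈ xs → y ∈ ys → x ≢ y
unique-++-disjoint (x ∷ xs) (p ∷ u) (here refl) y∈ = Allₚ.lookup p (∈-++⁺ʳ xs y∈)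
unique-++-disjoint (x ∷ xs) (p ∷ u) (there x∈) y∈ = unique-++-disjoint xs u x∈ y∈

unique-resp-↭ : {A : Set} {xs ys : List A} → xs ↭ ys → Unique xs → Unique ys
unique-resp-↭ ↭.refl u = u
unique-resp-↭ (↭.prep x p) (px ∷ u) = All-resp-↭ p px ∷ unique-resp-↭ p u
unique-resp-↭ (↭.swap x y p) ((x≢y ∷ px) ∷ py ∷ u) =
  ((λ e → x≢y (sym e)) ∷ All-resp-↭ p py) ∷ All-resp-↭ p px ∷ unique-resp-↭ p u
unique-resp-↭ (↭.trans p q) u = unique-resp-↭ q (unique-resp-↭ p u)

unique-sameElements⇒↭ : {A : Set} {xs ys : List A} → Unique xs → Unique ys →
  (∀ {z} → z ∈ xs → z ∈ ys) → (∀ {z} → z ∈ ys → z ∈ xs) → xs ↭ ys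
unique-sameElements⇒↭ ux uy f g = ∼bag⇒↭ (unique∧set⇒bag ux uy (mk⇔ f g))

map-unique : {A B : Set} {f : A → B} {xs : List A} → Unique xs →
  (∀ {x y} → x ∈ xs → y ∈ xs → f x ≡ f y → x ≡ y) → Unique (map f xs)
map-unique {xs = []} [] inj = []
map-unique {f = f} {xs = x ∷ xs} (px ∷ u) inj =
  Allₚ.tabulate fresh ∷ map-unique u (λ a b e → inj (there a) (there b) e)
  where
  fresh : ∀ {z} → z ∈ map f xs → f x ≡ z → ⊥
  fresh z∈ e with ∈-map⁻ f z∈
  ... | y , y∈ , refl = Allₚ.lookup px y∈ (inj (here refl) (there y∈) e)

concatMap-unique : {A B : Set} {h : A → List B} {xs : List A} → Unique xs →
  (∀ {x} → x ∈ xs → Unique (h x)) →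
  (∀ {x y z} → x ∈ xs → y ∈ xs → z ∈ h x → z ∈ h y → x ≡ y) →
  Unique (concatMap h xs)
concatMap-unique {xs = []} u hu dis = []
concatMap-unique {h = h} {xs = x ∷ xs} (px ∷ u) hu dis =
  Uniqueₚ.++⁺ (hu (here refl)) (concatMap-unique u (λ m → hu (there m)) (λ a b c d → dis (there a) (there b) c d)) disj
  where
  disj : ∀ {z} → z ∈ h x × z ∈ concatMap h xs → ⊥
  disj (z1 , z2) with find (∈-concatMap⁻ h {xs = xs} z2)
  ... | y , y∈ , z3 = Allₚ.lookup px y∈ (dis (here refl) (there y∈) z1 z3)

cartesianProductWith-unique : {A B C : Set} (f : A → B → C) {xs : List A} {ys : List B} →
  Unique xs → Unique ys →
  (∀ {a a' b b'} → a ∈ xs → a' ∈ xs → b ∈ ys → b' ∈ ys → f a b ≡ f a' b' → a ≡ a' × b ≡ b') →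
  Unique (cartesianProductWith f xs ys)
cartesianProductWith-unique f {[]} _ _ _ = []
cartesianProductWith-unique f {x ∷ xs} {ys} (px ∷ ux) uy inj =
  Uniqueₚ.++⁺ (map-unique uy (λ b b' e → proj₂ (inj (here refl) (here refl) b b' e)))
    (cartesianProductWith-unique f ux uy (λ a a' → inj (there a) (there a'))) disj
  where
  disj : ∀ {z} → z ∈ map (f x) ys × z ∈ cartesianProductWith f xs ys → ⊥
  disj (z∈ , z∈') with ∈-map⁻ (f x) z∈ | ∈-cartesianProductWith⁻ f xs ys z∈'
  ... | b , b∈ , refl | a , b' , a∈ , b'∈ , e =
    Allₚ.lookup px a∈ (proj₁ (inj (here refl) (there a∈) b∈ b'∈ e))

map-cartesianProductWith : {A B C D S T : Set} (g : C → D) (f : A → B → C)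
  (s : A → S) (t : B → T) (G : S → T → D) {xs : List A} {ys : List B} →
  (∀ {a b} → a ∈ xs → b ∈ ys → g (f a b) ≡ G (s a) (t b)) →
  map g (cartesianProductWith f xs ys) ≡ cartesianProductWith G (map s xs) (map t ys)
map-cartesianProductWith g f s t G {[]} h = refl
map-cartesianProductWith g f s t G {x ∷ xs} {ys} h = begin
  map g (map (f x) ys ++ cartesianProductWith f xs ys)
    ≡⟨ map-++ g (map (f x) ys) _ ⟩
  map g (map (f x) ys) ++ map g (cartesianProductWith f xs ys)
    ≡⟨ cong₂ _++_ row (map-cartesianProductWith g f s t G (h ∘ there)) ⟩
  map (G (s x)) (map t ys) ++ cartesianProductWith G (map s xs) (map t ys) ∎
  where
  open ≡-Reasoning
  row : map g (map (f x) ys) ≡ map (G (s x)) (map t ys)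
  row = begin
    map g (map (f x) ys)   ≡⟨ map-∘ ys ⟨
    map (g ∘ f x) ys       ≡⟨ map-cong-local (Allₚ.tabulate (h (here refl))) ⟩
    map (G (s x) ∘ t) ys   ≡⟨ map-∘ ys ⟩
    map (G (s x)) (map t ys) ∎

countᵇ-↭ : {A : Set} (p : A → Bool) {xs ys : List A} → xs ↭ ys → countᵇ p xs ≡ countᵇ p ys
countᵇ-↭ p ↭.refl = refl
countᵇ-↭ p (↭.prep x q) = cong ((if p x then 1 else 0) +_) (countᵇ-↭ p q)
countᵇ-↭ p {x ∷ y ∷ xs} (↭.swap x y q) =
  trans (sym (+-assoc (if p x then 1 else 0) (if p y then 1 else 0) _))
   (trans (cong₂ _+_ (+-comm (if p x then 1 else 0) (if p y then 1 else 0)) (countᵇ-↭ p q))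
     (+-assoc (if p y then 1 else 0) (if p x then 1 else 0) _))
countᵇ-↭ p (↭.trans q r) = trans (countᵇ-↭ p q) (countᵇ-↭ p r)

++-∷-cancel-∉ : {A : Set} {m : A} (xs xs' : List A) {ys ys' : List A} →
  m ∉ xs → m ∉ xs' → xs ++ m ∷ ys ≡ xs' ++ m ∷ ys' → xs ≡ xs' × ys ≡ ys'
++-∷-cancel-∉ [] [] n n' refl = refl , refl
++-∷-cancel-∉ [] (x ∷ xs') n n' refl = ⊥-elim (n' (here refl))
++-∷-cancel-∉ (x ∷ xs) [] n n' refl = ⊥-elim (n (here refl))
++-∷-cancel-∉ (x ∷ xs) (x' ∷ xs') n n' e with ∷-injective e
... | refl , e' with ++-∷-cancel-∉ xs xs' (n ∘ there) (n' ∘ there) e'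
... | refl , refl = refl , refl

snocView : {A : Set} (s : List A) → s ≢ [] → ∃ λ a → ∃ λ x → s ≡ a ++ [ x ]
snocView [] ne = ⊥-elim (ne refl)
snocView (x ∷ []) ne = [] , x , refl
snocView (x ∷ y ∷ s) ne with snocView (y ∷ s) (λ ())
... | a , z , e = x ∷ a , z , cong (x ∷_) e

length≡0 : {A : Set} (b : List A) → length b ≡ 0 → b ≡ []
length≡0 [] _ = refl

maxList-≤ : {xs : List ℕ} {y : ℕ} → y ∈ xs → y ≤ maxList xs
maxList-≤ {x ∷ xs} (here refl) = m≤m⊔n x (maxList xs)
maxList-≤ {x ∷ xs} (there m) = ≤-trans (maxList-≤ m) (m≤n⊔m x (maxList xs))

maxList-∈ : (xs : List ℕ) → 0 < maxList xs → maxList xs ∈ xs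
maxList-∈ [] ()
maxList-∈ (x ∷ xs) p with ⊔-sel x (maxList xs)
... | inj₁ e = subst (_∈ x ∷ xs) (sym e) (here refl)
... | inj₂ e = subst (_∈ x ∷ xs) (sym e) (there (maxList-∈ xs (subst (0 <_) e p)))

maxList-< : {xs : List ℕ} {y : ℕ} → All (_< y) xs → 0 < y → maxList xs < y
maxList-< [] p = p
maxList-< (q ∷ qs) p = ⊔-lub q (maxList-< qs p)

maxList-map-suc : (xs : List ℕ) → xs ≢ [] → maxList (map suc xs) ≡ suc (maxList xs)
maxList-map-suc [] ne = ⊥-elim (ne refl)
maxList-map-suc (x ∷ []) ne = trans (⊔-identityʳ (suc x)) (cong suc (sym (⊔-identityʳ x)))
maxList-map-suc (x ∷ y ∷ xs) ne = cong (suc x ⊔_) (maxList-map-suc (y ∷ xs) (λ ()))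

∈-insertAll⁺ : (x : ℕ) (u s : List ℕ) → u ++ x ∷ s ∈ insertAll x (u ++ s)
∈-insertAll⁺ x [] [] = here refl
∈-insertAll⁺ x [] (y ∷ s) = here refl
∈-insertAll⁺ x (y ∷ u) s = there (∈-map⁺ (y ∷_) (∈-insertAll⁺ x u s))

∈-insertAll⁻ : (x : ℕ) (ys : List ℕ) {z : List ℕ} → z ∈ insertAll x ys →
  ∃₂ λ u s → ys ≡ u ++ s × z ≡ u ++ x ∷ s
∈-insertAll⁻ x [] (here refl) = [] , [] , refl , refl
∈-insertAll⁻ x (y ∷ ys) (here refl) = [] , y ∷ ys , refl , refl
∈-insertAll⁻ x (y ∷ ys) (there m) with ∈-map⁻ (y ∷_) m
... | z' , m' , refl with ∈-insertAll⁻ x ys m'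
... | u , s , refl , refl = y ∷ u , s , refl , refl

∈-permutations⁻ : (ys : List ℕ) {z : List ℕ} → z ∈ permutations ys → z ↭ ys
∈-permutations⁻ [] (here refl) = ↭-refl
∈-permutations⁻ (x ∷ xs) m with find (∈-concatMap⁻ (insertAll x) {xs = permutations xs} m)
... | zs , zs∈ , z∈ with ∈-insertAll⁻ x zs z∈
... | u , s , refl , refl = ↭-trans (shift x u s) (↭.prep x (∈-permutations⁻ xs zs∈))

∈-permutations⁺ : (ys : List ℕ) {z : List ℕ} → z ↭ ys → z ∈ permutations ys
∈-permutations⁺ [] p with ↭-empty-inv p
... | refl = here refl
∈-permutations⁺ (x ∷ xs) p with ∈-∃++ (∈-resp-↭ (↭-sym p) (here refl))
... | u , s , refl =
  ∈-concatMap⁺ (insertAll x) (lose (∈-permutations⁺ xs (drop-mid u [] p)) (∈-insertAll⁺ x u s))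

insertAll-unique : (x : ℕ) (ys : List ℕ) → x ∉ ys → Unique (insertAll x ys)
insertAll-unique x [] nx = [] ∷ []
insertAll-unique x (y ∷ ys) nx =
  Allₚ.tabulate fresh ∷ Uniqueₚ.map⁺ ∷-injectiveʳ (insertAll-unique x ys (nx ∘ there))
  where
  fresh : ∀ {z} → z ∈ map (y ∷_) (insertAll x ys) → x ∷ y ∷ ys ≢ z
  fresh m refl with ∈-map⁻ (y ∷_) m
  ... | z' , _ , refl = nx (here refl)

delete : ℕ → List ℕ → List ℕ
delete x [] = []
delete x (y ∷ ys) with x ≟ y
... | yes _ = ys
... | no _ = y ∷ delete x ys

delete-++-∷ : (x : ℕ) (u s : List ℕ) → x ∉ u → delete x (u ++ x ∷ s) ≡ u ++ s
delete-++-∷ x [] s nu with x ≟ x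
... | yes _ = refl
... | no ne = ⊥-elim (ne refl)
delete-++-∷ x (y ∷ u) s nu with x ≟ y
... | yes refl = ⊥-elim (nu (here refl))
... | no _ = cong (y ∷_) (delete-++-∷ x u s (nu ∘ there))

delete-insertAll : (x : ℕ) (ys : List ℕ) {z : List ℕ} → x ∉ ys → z ∈ insertAll x ys → delete x z ≡ ys
delete-insertAll x ys nx m with ∈-insertAll⁻ x ys m
... | u , s , refl , refl = delete-++-∷ x u s (nx ∘ ∈-++⁺ˡ)

permutations-unique : (ys : List ℕ) → Unique ys → Unique (permutations ys)
permutations-unique [] u = [] ∷ []
permutations-unique (x ∷ xs) (px ∷ u) =
  concatMap-unique (permutations-unique xs u) (λ m → insertAll-unique x _ (x∉ m))
    (λ m1 m2 z1 z2 → trans (sym (delete-insertAll x _ (x∉ m1) z1)) (delete-insertAll x _ (x∉ m2) z2))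
  where
  x∉ : ∀ {zs} → zs ∈ permutations xs → x ∉ zs
  x∉ m x∈ = Allₚ.lookup px (∈-resp-↭ (∈-permutations⁻ xs m) x∈) refl

interval : ℕ → ℕ → List ℕ
interval a zero = []
interval a (suc n) = suc a ∷ interval (suc a) n

applyUpTo-cong : {f g : ℕ → ℕ} (n : ℕ) → (∀ i → f i ≡ g i) → applyUpTo f n ≡ applyUpTo g n
applyUpTo-cong zero h = refl
applyUpTo-cong (suc n) h = cong₂ _∷_ (h 0) (applyUpTo-cong n (h ∘ suc))

applyUpTo-interval : (a n : ℕ) → applyUpTo (λ i → suc (a + i)) n ≡ interval a n
applyUpTo-interval a zero = refl
applyUpTo-interval a (suc n) = cong₂ _∷_ (cong suc (+-identityʳ a))
  (trans (applyUpTo-cong n (λ i → cong suc (+-suc a i))) (applyUpTo-interval (suc a) n))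

labels≡interval : (n : ℕ) → labels n ≡ interval 0 n
labels≡interval n = trans (map-upTo suc n) (applyUpTo-interval 0 n)

interval-+ : (a m n : ℕ) → interval a (m + n) ≡ interval a m ++ interval (a + m) n
interval-+ a zero n = cong (λ z → interval z n) (sym (+-identityʳ a))
interval-+ a (suc m) n =
  cong (suc a ∷_) (trans (interval-+ (suc a) m n) (cong (λ z → interval (suc a) m ++ interval z n) (sym (+-suc a m))))

map-+-interval : (c a n : ℕ) → map (c +_) (interval a n) ≡ interval (c + a) n
map-+-interval c a zero = refl
map-+-interval c a (suc n) =
  cong₂ _∷_ (+-suc c a) (trans (map-+-interval c (suc a) n) (cong (λ z → interval z n) (+-suc c a)))

length-interval : (a n : ℕ) → length (interval a n) ≡ n
length-interval a zero = refl
length-interval a (suc n) = cong suc (length-interval (suc a) n)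

∈-interval⁻ : {a n y : ℕ} → y ∈ interval a n → a < y × y ≤ a + n
∈-interval⁻ {a} {suc n} (here refl) = ≤-refl , subst (suc a ≤_) (sym (+-suc a n)) (s≤s (m≤m+n a n))
∈-interval⁻ {a} {suc n} {y} (there m) with ∈-interval⁻ {suc a} {n} m
... | p , q = <-trans (n<1+n a) p , subst (y ≤_) (sym (+-suc a n)) q

∈-interval⁺ : {a n y : ℕ} → a < y → y ≤ a + n → y ∈ interval a n
∈-interval⁺ {a} {zero} {y} p q = ⊥-elim (<-irrefl refl (≤-trans p (subst (y ≤_) (+-identityʳ a) q)))
∈-interval⁺ {a} {suc n} {y} p q with m≤n⇒m<n∨m≡n p
... | inj₂ refl = here refl
... | inj₁ lt = there (∈-interval⁺ {suc a} {n} lt (subst (y ≤_) (+-suc a n) q))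

interval-unique : (a n : ℕ) → Unique (interval a n)
interval-unique a zero = []
interval-unique a (suc n) = Allₚ.tabulate (λ m e → <-irrefl e (proj₁ (∈-interval⁻ m))) ∷ interval-unique (suc a) n

sign : ℕ → ℕ
sign zero = 0
sign (suc _) = 1

allᵇ-false : {p : ℕ → Bool} (xs : List ℕ) {y : ℕ} → y ∈ xs → p y ≡ false → allᵇ p xs ≡ false
allᵇ-false (x ∷ xs) (here refl) e rewrite e = refl
allᵇ-false {p} (x ∷ xs) (there m) e with p x
... | true = allᵇ-false xs m e
... | false = refl

allᵇ-true : {p : ℕ → Bool} (xs : List ℕ) → All (λ y → p y ≡ true) xs → allᵇ p xs ≡ true
allᵇ-true [] [] = refl
allᵇ-true (x ∷ xs) (e ∷ es) rewrite e = allᵇ-true xs es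

allᵇ-sound : (p : ℕ → Bool) (xs : List ℕ) → allᵇ p xs ≡ true → All (λ x → p x ≡ true) xs
allᵇ-sound p [] _ = []
allᵇ-sound p (x ∷ xs) e = proj₁ (∧-true e) ∷ allᵇ-sound p xs (proj₂ (∧-true {p x} e))

anyᵇ-true : (p : ℕ → Bool) (xs : List ℕ) {y : ℕ} → y ∈ xs → p y ≡ true → anyᵇ p xs ≡ true
anyᵇ-true p (x ∷ xs) (here refl) e rewrite e = refl
anyᵇ-true p (x ∷ xs) (there m) e rewrite anyᵇ-true p xs m e = ∨-zeroʳ (p x)

anyᵇ-false : (p : ℕ → Bool) (xs : List ℕ) → All (λ y → p y ≡ false) xs → anyᵇ p xs ≡ false
anyᵇ-false p [] [] = refl
anyᵇ-false p (x ∷ xs) (e ∷ es) rewrite e = anyᵇ-false p xs es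

anyᵇ-++ : (p : ℕ → Bool) (xs ys : List ℕ) → anyᵇ p (xs ++ ys) ≡ (anyᵇ p xs ∨ anyᵇ p ys)
anyᵇ-++ p [] ys = refl
anyᵇ-++ p (x ∷ xs) ys rewrite anyᵇ-++ p xs ys = sym (∨-assoc (p x) _ _)

anyᵇ-shift : (c x y : ℕ) (xs : List ℕ) →
  anyᵇ (λ z → ((c + x) <ᵇ z) ∧ (z <ᵇ (c + y))) (map (c +_) xs) ≡ anyᵇ (λ z → (x <ᵇ z) ∧ (z <ᵇ y)) xs
anyᵇ-shift c x y [] = refl
anyᵇ-shift c x y (z ∷ xs) rewrite <ᵇ-shift c x z | <ᵇ-shift c z y | anyᵇ-shift c x y xs = refl

has21-shift : (c a : ℕ) (xs : List ℕ) → has21Above (c + a) (map (c +_) xs) ≡ has21Above a xs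
has21-shift c a [] = refl
has21-shift c a (b ∷ xs) rewrite <ᵇ-shift c a b | anyᵇ-shift c a b xs | has21-shift c a xs = refl

avoids-shift : (c : ℕ) (xs : List ℕ) → avoids132 (map (c +_) xs) ≡ avoids132 xs
avoids-shift c [] = refl
avoids-shift c (x ∷ xs) rewrite has21-shift c x xs | avoids-shift c xs = refl

des-shift : (c : ℕ) (xs : List ℕ) → des (map (c +_) xs) ≡ des xs
des-shift c [] = refl
des-shift c (x ∷ []) = refl
des-shift c (x ∷ y ∷ xs) = cong₂ (λ b n → (if b then 1 else 0) + n) (<ᵇ-shift c y x) (des-shift c (y ∷ xs))

lisAbove-shift : (c b : ℕ) (xs : List ℕ) → lisAbove (c + b) (map (c +_) xs) ≡ lisAbove b xs
lisAbove-shift c b [] = refl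
lisAbove-shift c b (x ∷ xs) rewrite <ᵇ-shift c b x | lisAbove-shift c x xs | lisAbove-shift c b xs = refl

rlmax-before-max : (A : List ℕ) (m : ℕ) (b : List ℕ) → All (_< m) A → rlmax (A ++ m ∷ b) ≡ rlmax (m ∷ b)
rlmax-before-max [] m b [] = refl
rlmax-before-max (x ∷ A) m b (p ∷ ps)
  rewrite allᵇ-false {λ y → y <ᵇ x} (A ++ m ∷ b) (∈-++⁺ʳ A (here refl)) (<ᵇ-false (<⇒≤ p)) = rlmax-before-max A m b ps

rlmax-max-∷ : (m : ℕ) (b : List ℕ) → All (_< m) b → rlmax (m ∷ b) ≡ suc (rlmax b)
rlmax-max-∷ m b ps rewrite allᵇ-true {λ y → y <ᵇ m} b (Allₚ.map <ᵇ-true ps) = refl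

des-++-∷ : (xs : List ℕ) (y : ℕ) (ys : List ℕ) → des (xs ++ y ∷ ys) ≡ des (xs ++ [ y ]) + des (y ∷ ys)
des-++-∷ [] y ys = refl
des-++-∷ (x ∷ []) y ys = cong (_+ des (y ∷ ys)) (sym (+-identityʳ _))
des-++-∷ (x ∷ x' ∷ xs) y ys = trans (cong (d +_) (des-++-∷ (x' ∷ xs) y ys)) (sym (+-assoc d _ _))
  where d = if x' <ᵇ x then 1 else 0

des-∷ʳ-max : (xs : List ℕ) (m : ℕ) → All (_< m) xs → des (xs ++ [ m ]) ≡ des xs
des-∷ʳ-max [] m _ = refl
des-∷ʳ-max (x ∷ []) m (p ∷ _) rewrite <ᵇ-false {m} {x} (<⇒≤ p) = refl
des-∷ʳ-max (x ∷ x' ∷ xs) m (p ∷ ps) = cong (_ +_) (des-∷ʳ-max (x' ∷ xs) m ps)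

des-max-∷ : (m : ℕ) (b : List ℕ) → All (_< m) b → des (m ∷ b) ≡ sign (length b) + des b
des-max-∷ m [] _ = refl
des-max-∷ m (y ∷ b) (p ∷ _) rewrite <ᵇ-true p = refl

lisAbove-below : (x : ℕ) (ys : List ℕ) → All (_≤ x) ys → lisAbove x ys ≡ 0
lisAbove-below x [] [] = refl
lisAbove-below x (y ∷ ys) (p ∷ ps) rewrite <ᵇ-false p = lisAbove-below x ys ps

lisAbove-++ : (t : ℕ) (xs ys : List ℕ) → All (λ x → All (_< x) ys) xs →
  lisAbove t (xs ++ ys) ≡ lisAbove t xs ⊔ lisAbove t ys
lisAbove-++ t [] ys _ = refl
lisAbove-++ t (x ∷ xs) ys (p ∷ ps) with t <ᵇ x
... | true rewrite lisAbove-++ x xs ys ps | lisAbove-below x ys (Allₚ.map <⇒≤ p)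
                 | lisAbove-++ t xs ys ps | ⊔-identityʳ (lisAbove x xs) =
  sym (⊔-assoc (suc (lisAbove x xs)) (lisAbove t xs) (lisAbove t ys))
... | false = lisAbove-++ t xs ys ps

lisAbove-∷ʳ-max : (t : ℕ) (xs : List ℕ) (m : ℕ) → All (_< m) xs → t < m →
  lisAbove t (xs ++ [ m ]) ≡ suc (lisAbove t xs)
lisAbove-∷ʳ-max t [] m [] p rewrite <ᵇ-true p = refl
lisAbove-∷ʳ-max t (x ∷ xs) m (q ∷ qs) p with t <ᵇ x
... | true rewrite lisAbove-∷ʳ-max x xs m qs q | lisAbove-∷ʳ-max t xs m qs p = refl
... | false = lisAbove-∷ʳ-max t xs m qs p

lisAbove-raise : (b b' : ℕ) (xs : List ℕ) → All (b' <_) xs → b ≤ b' → lisAbove b xs ≡ lisAbove b' xs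
lisAbove-raise b b' [] _ _ = refl
lisAbove-raise b b' (x ∷ xs) (p ∷ ps) q
  rewrite <ᵇ-true p | <ᵇ-true (≤-<-trans q p) | lisAbove-raise b b' xs ps q = refl

lis≡lisAbove0 : (xs : List ℕ) → All (0 <_) xs → lis xs ≡ lisAbove 0 xs
lis≡lisAbove0 [] _ = refl
lis≡lisAbove0 (suc x ∷ xs) (_ ∷ ps) = cong (suc (lisAbove (suc x) xs) ⊔_) (lis≡lisAbove0 xs ps)

has21-below : (a : ℕ) (ys : List ℕ) → All (_≤ a) ys → has21Above a ys ≡ false
has21-below a [] [] = refl
has21-below a (y ∷ ys) (p ∷ ps) rewrite <ᵇ-false p = has21-below a ys ps

has21-++-below : (a : ℕ) (xs ys : List ℕ) → All (_≤ a) ys → has21Above a (xs ++ ys) ≡ has21Above a xs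
has21-++-below a [] ys ps = has21-below a ys ps
has21-++-below a (x ∷ xs) ys ps
  rewrite anyᵇ-++ (λ c → (a <ᵇ c) ∧ (c <ᵇ x)) xs ys
        | anyᵇ-false (λ c → (a <ᵇ c) ∧ (c <ᵇ x)) ys (Allₚ.map (λ {c} q → cong (_∧ (c <ᵇ x)) (<ᵇ-false q)) ps)
        | ∨-identityʳ (anyᵇ (λ c → (a <ᵇ c) ∧ (c <ᵇ x)) xs)
        | has21-++-below a xs ys ps = refl

has21-∷ʳ-max : (a : ℕ) (xs : List ℕ) (m : ℕ) → All (_< m) xs → has21Above a (xs ++ [ m ]) ≡ has21Above a xs
has21-∷ʳ-max a [] m [] = cong (_∨ false) (∧-zeroʳ (a <ᵇ m))
has21-∷ʳ-max a (x ∷ xs) m (p ∷ ps)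
  rewrite anyᵇ-++ (λ c → (a <ᵇ c) ∧ (c <ᵇ x)) xs [ m ]
        | <ᵇ-false {m} {x} (<⇒≤ p) | ∧-zeroʳ (a <ᵇ m)
        | ∨-identityʳ (anyᵇ (λ c → (a <ᵇ c) ∧ (c <ᵇ x)) xs)
        | has21-∷ʳ-max a xs m ps = refl

has21-++ : (a : ℕ) (xs ys : List ℕ) → has21Above a xs ≡ true → has21Above a (xs ++ ys) ≡ true
has21-++ a (x ∷ xs) ys p with ∨-true {(a <ᵇ x) ∧ anyᵇ (λ c → (a <ᵇ c) ∧ (c <ᵇ x)) xs} p
... | inj₂ q rewrite has21-++ a xs ys q = ∨-zeroʳ _
... | inj₁ q with ∧-true q
... | q1 , q2 = ∨-introˡ {c = has21Above a (xs ++ ys)}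
  (∧-intro q1 (trans (anyᵇ-++ (λ c → (a <ᵇ c) ∧ (c <ᵇ x)) xs ys) (∨-introˡ {c = anyᵇ (λ c → (a <ᵇ c) ∧ (c <ᵇ x)) ys} q2)))

has21-witness : (x m y : ℕ) (u b : List ℕ) → x < m → y ∈ b → x < y → y < m →
  has21Above x (u ++ m ∷ b) ≡ true
has21-witness x m y [] b xm yb xy ym
  rewrite <ᵇ-true xm | anyᵇ-true (λ c → (x <ᵇ c) ∧ (c <ᵇ m)) b yb (cong₂ _∧_ (<ᵇ-true xy) (<ᵇ-true ym)) = refl
has21-witness x m y (z ∷ u) b xm yb xy ym rewrite has21-witness x m y u b xm yb xy ym = ∨-zeroʳ _

avoids-++ : (xs ys : List ℕ) → All (λ x → All (_< x) ys) xs →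
  avoids132 (xs ++ ys) ≡ (avoids132 xs ∧ avoids132 ys)
avoids-++ [] ys _ = refl
avoids-++ (x ∷ xs) ys (p ∷ ps)
  rewrite has21-++-below x xs ys (Allₚ.map <⇒≤ p) | avoids-++ xs ys ps = sym (∧-assoc (not (has21Above x xs)) _ _)

avoids-∷ʳ-max : (xs : List ℕ) (m : ℕ) → All (_< m) xs → avoids132 (xs ++ [ m ]) ≡ avoids132 xs
avoids-∷ʳ-max [] m _ = refl
avoids-∷ʳ-max (x ∷ xs) m (p ∷ ps) rewrite has21-∷ʳ-max x xs m ps | avoids-∷ʳ-max xs m ps = refl

avoids-suffix : (xs ys : List ℕ) → avoids132 (xs ++ ys) ≡ true → avoids132 ys ≡ true
avoids-suffix [] ys p = p
avoids-suffix (x ∷ xs) ys p = avoids-suffix xs ys (proj₂ (∧-true p))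

avoids-prefix : (xs ys : List ℕ) → avoids132 (xs ++ ys) ≡ true → avoids132 xs ≡ true
avoids-prefix [] ys p = refl
avoids-prefix (x ∷ xs) ys p with ∧-true p
... | p1 , p2 with has21Above x xs in eq
... | true = ⊥-elim (true≢false (trans (sym (has21-++ x xs ys eq)) (not-true p1)))
... | false = avoids-prefix xs ys p2

avoids-max-separates : (u : List ℕ) (m : ℕ) (b : List ℕ) → avoids132 (u ++ m ∷ b) ≡ true →
  {x y : ℕ} → x ∈ u → y ∈ b → x < m → x < y → y < m → ⊥
avoids-max-separates u m b av {x} {y} xu yb xm xy ym with ∈-∃++ xu
... | u1 , u2 , refl with ∧-true (avoids-suffix u1 (x ∷ (u2 ++ m ∷ b)) (subst (λ z → avoids132 z ≡ true) (++-assoc u1 (x ∷ u2) (m ∷ b)) av))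
... | p1 , _ = true≢false (trans (sym (has21-witness x m y u2 b xm yb xy ym)) (not-true p1))

splits : ℕ → List (ℕ × ℕ)
splits zero = (0 , 0) ∷ []
splits (suc n) = (0 , suc n) ∷ map (map₁ suc) (splits n)

∈-splits⁻ : {n q c : ℕ} → (q , c) ∈ splits n → q + c ≡ n
∈-splits⁻ {zero} (here refl) = refl
∈-splits⁻ {suc n} (here refl) = refl
∈-splits⁻ {suc n} (there m) with ∈-map⁻ (map₁ suc) m
... | _ , m' , refl = cong suc (∈-splits⁻ m')

∈-splits⁺ : {n q c : ℕ} → q + c ≡ n → (q , c) ∈ splits n
∈-splits⁺ {zero} {zero} {zero} e = here refl
∈-splits⁺ {suc n} {zero} refl = here refl
∈-splits⁺ {suc n} {suc q} e = there (∈-map⁺ (map₁ suc) (∈-splits⁺ {n} {q} (suc-injective e)))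

splits-unique : (n : ℕ) → Unique (splits n)
splits-unique zero = [] ∷ []
splits-unique (suc n) = Allₚ.tabulate fresh ∷ Uniqueₚ.map⁺ suc-injectiveˡ (splits-unique n)
  where
  suc-injectiveˡ : ∀ {x y : ℕ × ℕ} → map₁ suc x ≡ map₁ suc y → x ≡ y
  suc-injectiveˡ {_ , _} {_ , _} refl = refl
  fresh : ∀ {z} → z ∈ map (map₁ suc) (splits n) → (0 , suc n) ≢ z
  fresh m e with ∈-map⁻ (map₁ suc) m
  fresh m () | _ , _ , refl

concatMap-cong-local : {A B : Set} {h k : A → List B} (xs : List A) → (∀ {x} → x ∈ xs → h x ≡ k x) →
  concatMap h xs ≡ concatMap k xs
concatMap-cong-local xs p = cong concat (map-cong-local (Allₚ.tabulate p))

-- An object of size n + 1 is built from a left part of size q and a right part of size c,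
-- q + c ≡ n, for the admissible splits (q , c).
module Generation (admissible : ℕ × ℕ → Bool) where

  admissibleSplits : ℕ → List (ℕ × ℕ)
  admissibleSplits n = filter (T? ∘ admissible) (splits n)

  ∈-admissibleSplits⁻ : {n q c : ℕ} → (q , c) ∈ admissibleSplits n → q + c ≡ n × admissible (q , c) ≡ true
  ∈-admissibleSplits⁻ m with ∈-filter⁻ (T? ∘ admissible) m
  ... | m' , t = ∈-splits⁻ m' , Equivalence.to T-≡ t

  ∈-admissibleSplits⁺ : {n q c : ℕ} → q + c ≡ n → admissible (q , c) ≡ true → (q , c) ∈ admissibleSplits n
  ∈-admissibleSplits⁺ e t = ∈-filter⁺ (T? ∘ admissible) (∈-splits⁺ e) (Equivalence.from T-≡ t)

  admissibleSplits-unique : (n : ℕ) → Unique (admissibleSplits n)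
  admissibleSplits-unique n = Uniqueₚ.filter⁺ (T? ∘ admissible) (splits-unique n)

  module _ {X : Set} (join : ℕ → ℕ → X → X → X) (empty : X) where

    joinAll : (ℕ → List X) → ℕ × ℕ → List X
    joinAll g (q , c) = cartesianProductWith (join q c) (g q) (g c)

    -- generate f L lists the objects of size L as long as the fuel f exceeds L (and is [] otherwise).
    generate : ℕ → ℕ → List X
    generate zero L = []
    generate (suc f) zero = empty ∷ []
    generate (suc f) (suc n) = concatMap (joinAll (generate f)) (admissibleSplits n)

    ∈-generate⁻ : {f n : ℕ} {x : X} → x ∈ generate (suc f) (suc n) →
      ∃ λ q → ∃ λ c → ∃ λ a → ∃ λ b →
        (q , c) ∈ admissibleSplits n × a ∈ generate f q × b ∈ generate f c × x ≡ join q c a b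
    ∈-generate⁻ {f} {n} m with find (∈-concatMap⁻ (joinAll (generate f)) {xs = admissibleSplits n} m)
    ... | (q , c) , qc∈ , m' with ∈-cartesianProductWith⁻ (join q c) (generate f q) (generate f c) m'
    ... | a , b , a∈ , b∈ , refl = q , c , a , b , qc∈ , a∈ , b∈ , refl

    ∈-generate⁺ : {f n q c : ℕ} {a b : X} → (q , c) ∈ admissibleSplits n → a ∈ generate f q → b ∈ generate f c →
      join q c a b ∈ generate (suc f) (suc n)
    ∈-generate⁺ {f} {q = q} {c} qc∈ a∈ b∈ =
      ∈-concatMap⁺ (joinAll (generate f)) (lose qc∈ (∈-cartesianProductWith⁺ (join q c) a∈ b∈))

  module _ {X : Set} (join : ℕ → ℕ → X → X → X) (empty : X) (Valid : ℕ → X → Set)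
    (sound : ∀ {f L x} → x ∈ generate join empty f L → Valid L x)
    (injective : ∀ {n q c q' c' a b a' b'} → (q , c) ∈ admissibleSplits n → (q' , c') ∈ admissibleSplits n →
       Valid q a → Valid c b → Valid q' a' → Valid c' b' → join q c a b ≡ join q' c' a' b' →
       (q , c) ≡ (q' , c') × a ≡ a' × b ≡ b') where

    generate-unique : (f L : ℕ) → Unique (generate join empty f L)
    generate-unique zero L = []
    generate-unique (suc f) zero = [] ∷ []
    generate-unique (suc f) (suc n) = concatMap-unique (admissibleSplits-unique n) perSplit disjoint
      where
      g = generate join empty f
      perSplit : ∀ {qc} → qc ∈ admissibleSplits n → Unique (joinAll join empty g qc)
      perSplit {q , c} m = cartesianProductWith-unique (join q c) (generate-unique f q) (generate-unique f c)
        (λ a∈ a'∈ b∈ b'∈ e → proj₂ (injective {n = n} m m (sound {f = f} a∈) (sound {f = f} b∈) (sound {f = f} a'∈) (sound {f = f} b'∈) e))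
      disjoint : ∀ {qc qc' z} → qc ∈ admissibleSplits n → qc' ∈ admissibleSplits n →
        z ∈ joinAll join empty g qc → z ∈ joinAll join empty g qc' → qc ≡ qc'
      disjoint {q , c} {q' , c'} m m' z∈ z∈'
        with ∈-cartesianProductWith⁻ (join q c) (g q) (g c) z∈ | ∈-cartesianProductWith⁻ (join q' c') (g q') (g c') z∈'
      ... | a , b , a∈ , b∈ , refl | a' , b' , a'∈ , b'∈ , e =
        proj₁ (injective {n = n} m m' (sound {f = f} a∈) (sound {f = f} b∈) (sound {f = f} a'∈) (sound {f = f} b'∈) e)

  module _ {X Y S : Set} (join₁ : ℕ → ℕ → X → X → X) (empty₁ : X) (join₂ : ℕ → ℕ → Y → Y → Y) (empty₂ : Y)
    (st₁ : ℕ → X → S) (st₂ : ℕ → Y → S) (joinStats : ℕ → ℕ → S → S → S)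
    (base : st₁ 0 empty₁ ≡ st₂ 0 empty₂)
    (step₁ : ∀ {f n q c a b} → (q , c) ∈ admissibleSplits n → a ∈ generate join₁ empty₁ f q → b ∈ generate join₁ empty₁ f c →
          st₁ (suc n) (join₁ q c a b) ≡ joinStats q c (st₁ q a) (st₁ c b))
    (step₂ : ∀ {f n q c a b} → (q , c) ∈ admissibleSplits n → a ∈ generate join₂ empty₂ f q → b ∈ generate join₂ empty₂ f c →
          st₂ (suc n) (join₂ q c a b) ≡ joinStats q c (st₂ q a) (st₂ c b)) where

    generate-stats : (f L : ℕ) → map (st₁ L) (generate join₁ empty₁ f L) ≡ map (st₂ L) (generate join₂ empty₂ f L)
    generate-stats zero L = refl
    generate-stats (suc f) zero = cong [_] base
    generate-stats (suc f) (suc n) = begin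
      map (st₁ (suc n)) (concatMap (joinAll join₁ empty₁ g₁) (admissibleSplits n))
        ≡⟨ map-concatMap (st₁ (suc n)) (joinAll join₁ empty₁ g₁) (admissibleSplits n) ⟩
      concatMap (map (st₁ (suc n)) ∘ joinAll join₁ empty₁ g₁) (admissibleSplits n)
        ≡⟨ concatMap-cong-local (admissibleSplits n) perSplit ⟩
      concatMap (map (st₂ (suc n)) ∘ joinAll join₂ empty₂ g₂) (admissibleSplits n)
        ≡⟨ map-concatMap (st₂ (suc n)) (joinAll join₂ empty₂ g₂) (admissibleSplits n) ⟨
      map (st₂ (suc n)) (concatMap (joinAll join₂ empty₂ g₂) (admissibleSplits n)) ∎
      where
      open ≡-Reasoning
      g₁ = generate join₁ empty₁ f
      g₂ = generate join₂ empty₂ f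
      perSplit : ∀ {qc} → qc ∈ admissibleSplits n →
        map (st₁ (suc n)) (joinAll join₁ empty₁ g₁ qc) ≡ map (st₂ (suc n)) (joinAll join₂ empty₂ g₂ qc)
      perSplit {q , c} m = begin
        map (st₁ (suc n)) (cartesianProductWith (join₁ q c) (g₁ q) (g₁ c))
          ≡⟨ map-cartesianProductWith (st₁ (suc n)) (join₁ q c) (st₁ q) (st₁ c) (joinStats q c) (step₁ {f = f} m) ⟩
        cartesianProductWith (joinStats q c) (map (st₁ q) (g₁ q)) (map (st₁ c) (g₁ c))
          ≡⟨ cong₂ (cartesianProductWith (joinStats q c)) (generate-stats f q) (generate-stats f c) ⟩
        cartesianProductWith (joinStats q c) (map (st₂ q) (g₂ q)) (map (st₂ c) (g₂ c))
          ≡⟨ map-cartesianProductWith (st₂ (suc n)) (join₂ q c) (st₂ q) (st₂ c) (joinStats q c) (step₂ {f = f} m) ⟨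
        map (st₂ (suc n)) (cartesianProductWith (join₂ q c) (g₂ q) (g₂ c)) ∎

-- The left part a is shifted above the right part b, as it must be in a 132-avoider.
joinPerm : ℕ → ℕ → List ℕ → List ℕ → List ℕ
joinPerm q c a b = map (c +_) a ++ suc (q + c) ∷ b

∈-↭interval⁻ : {L : ℕ} {π : List ℕ} → π ↭ interval 0 L → {y : ℕ} → y ∈ π → 0 < y × y ≤ L
∈-↭interval⁻ p y∈ = ∈-interval⁻ (∈-resp-↭ p y∈)

length-↭interval : {L : ℕ} {π : List ℕ} → π ↭ interval 0 L → length π ≡ L
length-↭interval {L} p = trans (↭-length p) (length-interval 0 L)

interval-suc : (n : ℕ) → interval 0 (suc n) ≡ interval 0 n ++ [ suc n ]
interval-suc n = trans (cong (interval 0) (+-comm 1 n)) (interval-+ 0 n 1)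

interval-split : (q c : ℕ) → interval 0 (suc (q + c)) ≡ interval 0 c ++ (interval c q ++ [ suc (q + c) ])
interval-split q c = begin
  interval 0 (suc (q + c))                        ≡⟨ cong (interval 0) (trans (cong suc (+-comm q c)) (sym (+-suc c q))) ⟩
  interval 0 (c + suc q)                          ≡⟨ interval-+ 0 c (suc q) ⟩
  interval 0 c ++ interval c (suc q)              ≡⟨ cong (λ z → interval 0 c ++ interval c z) (+-comm 1 q) ⟩
  interval 0 c ++ interval c (q + 1)              ≡⟨ cong (interval 0 c ++_) (interval-+ c q 1) ⟩
  interval 0 c ++ (interval c q ++ interval (c + q) 1)
                                                  ≡⟨ cong (λ z → interval 0 c ++ (interval c q ++ interval z 1)) (+-comm c q) ⟩
  interval 0 c ++ (interval c q ++ [ suc (q + c) ]) ∎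
  where open ≡-Reasoning

map-+-↭interval : (c q : ℕ) {a : List ℕ} → a ↭ interval 0 q → map (c +_) a ↭ interval c q
map-+-↭interval c q {a} pa =
  subst (map (c +_) a ↭_) (trans (map-+-interval c 0 q) (cong (λ z → interval z q) (+-identityʳ c))) (↭-map⁺ (c +_) pa)

joinPerm-↭ : (q c : ℕ) {a b : List ℕ} → a ↭ interval 0 q → b ↭ interval 0 c →
  joinPerm q c a b ↭ interval 0 (suc (q + c))
joinPerm-↭ q c {a} {b} pa pb = subst (joinPerm q c a b ↭_) (sym (interval-split q c)) (↭-trans regroup swap)
  where
  top = [ suc (q + c) ]
  regroup : joinPerm q c a b ↭ (interval c q ++ top) ++ interval 0 c
  regroup = subst (_↭ (interval c q ++ top) ++ interval 0 c) (++-assoc (map (c +_) a) top b)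
              (↭-++⁺ (↭-++⁺ʳ top (map-+-↭interval c q pa)) pb)
  swap : (interval c q ++ top) ++ interval 0 c ↭ interval 0 c ++ (interval c q ++ top)
  swap = ↭-++-comm (interval c q ++ top) (interval 0 c)

joinPerm-left-bounds : (q c : ℕ) {a : List ℕ} → a ↭ interval 0 q → All (λ x → c < x × x < suc (q + c)) (map (c +_) a)
joinPerm-left-bounds q c {a} pa = Allₚ.tabulate bounds
  where
  bounds : ∀ {x} → x ∈ map (c +_) a → c < x × x < suc (q + c)
  bounds m with ∈-map⁻ (c +_) m
  ... | y , y∈ , refl with ∈-↭interval⁻ pa y∈
  ... | p1 , p2 = subst (_< c + y) (+-identityʳ c) (+-monoʳ-< c p1) ,
                  s≤s (subst (c + y ≤_) (+-comm c q) (+-monoʳ-≤ c p2))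

joinPerm-right-bounds : (q c : ℕ) {b : List ℕ} → b ↭ interval 0 c → All (λ y → 0 < y × y ≤ c) b
joinPerm-right-bounds q c pb = Allₚ.tabulate (∈-↭interval⁻ pb)

joinPerm-left<max : (q c : ℕ) {a : List ℕ} → a ↭ interval 0 q → All (_< suc (q + c)) (map (c +_) a)
joinPerm-left<max q c pa = Allₚ.map proj₂ (joinPerm-left-bounds q c pa)

joinPerm-right<max : (q c : ℕ) {b : List ℕ} → b ↭ interval 0 c → All (_< suc (q + c)) b
joinPerm-right<max q c pb = Allₚ.map (λ (_ , y≤c) → s≤s (≤-trans y≤c (m≤n+m c q))) (joinPerm-right-bounds q c pb)

joinPerm-separated : (q c : ℕ) {a b : List ℕ} → a ↭ interval 0 q → b ↭ interval 0 c →
  All (λ x → All (_< x) b) (map (c +_) a ++ [ suc (q + c) ])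
joinPerm-separated q c {a} {b} pa pb = Allₚ.tabulate above
  where
  b≤c : All (_≤ c) b
  b≤c = Allₚ.map proj₂ (joinPerm-right-bounds q c pb)
  above : ∀ {x} → x ∈ map (c +_) a ++ [ suc (q + c) ] → All (_< x) b
  above m with ∈-++⁻ (map (c +_) a) m
  ... | inj₁ xA = Allₚ.map (λ y≤ → ≤-<-trans y≤ (proj₁ (Allₚ.lookup (joinPerm-left-bounds q c pa) xA))) b≤c
  ... | inj₂ (here refl) = joinPerm-right<max q c pb

joinPerm-avoids : (q c : ℕ) {a b : List ℕ} → a ↭ interval 0 q → b ↭ interval 0 c →
  avoids132 (joinPerm q c a b) ≡ (avoids132 a ∧ avoids132 b)
joinPerm-avoids q c {a} {b} pa pb = begin
  avoids132 (map (c +_) a ++ L ∷ b)                     ≡⟨ cong avoids132 (++-assoc (map (c +_) a) [ L ] b) ⟨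
  avoids132 ((map (c +_) a ++ [ L ]) ++ b)              ≡⟨ avoids-++ (map (c +_) a ++ [ L ]) b (joinPerm-separated q c pa pb) ⟩
  avoids132 (map (c +_) a ++ [ L ]) ∧ avoids132 b
      ≡⟨ cong (_∧ avoids132 b) (avoids-∷ʳ-max (map (c +_) a) L (joinPerm-left<max q c pa)) ⟩
  avoids132 (map (c +_) a) ∧ avoids132 b                ≡⟨ cong (_∧ avoids132 b) (avoids-shift c a) ⟩
  avoids132 a ∧ avoids132 b ∎
  where
  open ≡-Reasoning
  L = suc (q + c)

joinPerm-injective : {n q c q' c' : ℕ} {a b a' b' : List ℕ} → q + c ≡ n → q' + c' ≡ n →
  a ↭ interval 0 q → b ↭ interval 0 c → a' ↭ interval 0 q' → b' ↭ interval 0 c' →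
  joinPerm q c a b ≡ joinPerm q' c' a' b' → (q , c) ≡ (q' , c') × a ≡ a' × b ≡ b'
joinPerm-injective {n} {q} {c} {q'} {c'} {a} {b} {a'} {b'} e e' pa pb pa' pb' eq =
  cong₂ _,_ q≡q' c≡c' , a≡a' , b≡b'
  where
  max∉ : ∀ {q c a} → q + c ≡ n → a ↭ interval 0 q → suc n ∉ map (c +_) a
  max∉ {q} {c} e pa m = <-irrefl (cong suc (sym e)) (proj₂ (Allₚ.lookup (joinPerm-left-bounds q c pa) m))
  halves = ++-∷-cancel-∉ (map (c +_) a) (map (c' +_) a') (max∉ e pa) (max∉ e' pa')
    (subst₂ (λ x y → map (c +_) a ++ suc x ∷ b ≡ map (c' +_) a' ++ suc y ∷ b') e e' eq)
  b≡b' = proj₂ halves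
  c≡c' : c ≡ c'
  c≡c' = trans (sym (length-↭interval pb)) (trans (cong length b≡b') (length-↭interval pb'))
  q≡q' : q ≡ q'
  q≡q' = +-cancelʳ-≡ c q q' (trans e (sym (trans (cong (q' +_) c≡c') e')))
  a≡a' : a ≡ a'
  a≡a' = map-injective (+-cancelˡ-≡ c _ _) (trans (proj₁ halves) (cong (λ z → map (z +_) a') (sym c≡c')))

max-split : (n : ℕ) {π : List ℕ} → π ↭ interval 0 (suc n) →
  ∃₂ λ u b → π ≡ u ++ suc n ∷ b × u ++ b ↭ interval 0 n
max-split n {π} p with ∈-∃++ (∈-resp-↭ (↭-sym p) (∈-interval⁺ {0} {suc n} (s≤s z≤n) ≤-refl))
... | u , b , refl = u , b , refl ,
  subst (u ++ b ↭_) (++-identityʳ (interval 0 n)) (drop-mid u (interval 0 n) (subst (u ++ suc n ∷ b ↭_) (interval-suc n) p))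

avoider-separated : (n : ℕ) {u b : List ℕ} → avoids132 (u ++ suc n ∷ b) ≡ true → u ++ b ↭ interval 0 n →
  ∀ {x y} → x ∈ u → y ∈ b → y < x
avoider-separated n {u} {b} av p {x} {y} x∈ y∈ with <-cmp x y
... | tri< lt _ _ = ⊥-elim (avoids-max-separates u (suc n) b av x∈ y∈ (s≤s (proj₂ (bound (∈-++⁺ˡ x∈)))) lt (s≤s (proj₂ (bound (∈-++⁺ʳ u y∈)))))
  where bound = ∈-↭interval⁻ p
... | tri≈ _ eq _ = ⊥-elim (unique-++-disjoint u (unique-resp-↭ (↭-sym p) (interval-unique 0 n)) x∈ y∈ eq)
... | tri> _ _ gt = gt

separated-halves : (n : ℕ) {u b : List ℕ} → u ++ b ↭ interval 0 n → (∀ {x y} → x ∈ u → y ∈ b → y < x) →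
  ∃ λ k → length u + k ≡ n × u ↭ interval k (length u) × b ↭ interval 0 k
separated-halves n {u} {b} p below = k , q+k≡n , u↭ , b↭
  where
  unique = unique-resp-↭ (↭-sym p) (interval-unique 0 n)
  bound : ∀ {y} → y ∈ u ++ b → 0 < y × y ≤ n
  bound = ∈-↭interval⁻ p
  inUB : ∀ {y} → 0 < y → y ≤ n → y ∈ u ++ b
  inUB p0 pn = ∈-resp-↭ (↭-sym p) (∈-interval⁺ p0 pn)
  k = maxList b
  k≤n : k ≤ n
  k≤n with k ≟ 0
  ... | yes e = subst (_≤ n) (sym e) z≤n
  ... | no ne = proj₂ (bound (∈-++⁺ʳ u (maxList-∈ b (n≢0⇒n>0 ne))))
  b↭ : b ↭ interval 0 k
  b↭ = unique-sameElements⇒↭ (unique-++⁻ʳ u unique) (interval-unique 0 k)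
    (λ y∈ → ∈-interval⁺ (proj₁ (bound (∈-++⁺ʳ u y∈))) (maxList-≤ y∈)) fromInterval
    where
    fromInterval : ∀ {y} → y ∈ interval 0 k → y ∈ b
    fromInterval y∈ with ∈-interval⁻ {0} {k} y∈
    ... | p0 , pk with ∈-++⁻ u (inUB p0 (≤-trans pk k≤n))
    ... | inj₂ yb = yb
    ... | inj₁ yu = ⊥-elim (<-irrefl refl (<-≤-trans (below yu (maxList-∈ b (<-≤-trans p0 pk))) pk))
  q = length u
  q+k≡n : q + k ≡ n
  q+k≡n = trans (cong (q +_) (sym (length-↭interval b↭))) (trans (sym (length-++ u)) (length-↭interval p))
  u↭ : u ↭ interval k q
  u↭ = unique-sameElements⇒↭ (unique-++⁻ˡ u unique) (interval-unique k q) toInterval fromInterval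
    where
    toInterval : ∀ {y} → y ∈ u → y ∈ interval k q
    toInterval {y} y∈ = ∈-interval⁺ (maxList-< (Allₚ.tabulate (below y∈)) (proj₁ (bound (∈-++⁺ˡ y∈))))
                                     (subst (y ≤_) (trans (sym q+k≡n) (+-comm q k)) (proj₂ (bound (∈-++⁺ˡ y∈))))
    fromInterval : ∀ {y} → y ∈ interval k q → y ∈ u
    fromInterval {y} y∈ with ∈-interval⁻ {k} {q} y∈
    ... | p0 , pk with ∈-++⁻ u (inUB (≤-<-trans z≤n p0) (subst (y ≤_) (trans (+-comm k q) q+k≡n) pk))
    ... | inj₁ yu = yu
    ... | inj₂ yb = ⊥-elim (<-irrefl refl (<-≤-trans p0 (maxList-≤ yb)))

unshift : (k q : ℕ) {u : List ℕ} → u ↭ interval k q → ∃ λ a → u ≡ map (k +_) a × a ↭ interval 0 q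
unshift k q {u} p = map (_∸ k) u , sym shift-back , subst (map (_∸ k) u ↭_) down (↭-map⁺ (_∸ k) p)
  where
  open ≡-Reasoning
  shift-back : map (k +_) (map (_∸ k) u) ≡ u
  shift-back = begin
    map (k +_) (map (_∸ k) u)   ≡⟨ map-∘ u ⟨
    map (λ y → k + (y ∸ k)) u   ≡⟨ map-cong-local (Allₚ.tabulate (λ y∈ → m+[n∸m]≡n (<⇒≤ (proj₁ (∈-interval⁻ (∈-resp-↭ p y∈)))))) ⟩
    map (λ y → y) u             ≡⟨ map-id u ⟩
    u ∎
  down : map (_∸ k) (interval k q) ≡ interval 0 q
  down = begin
    map (_∸ k) (interval k q)               ≡⟨ cong (λ z → map (_∸ k) (interval z q)) (+-identityʳ k) ⟨
    map (_∸ k) (interval (k + 0) q)         ≡⟨ cong (map (_∸ k)) (map-+-interval k 0 q) ⟨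
    map (_∸ k) (map (k +_) (interval 0 q))  ≡⟨ map-∘ (interval 0 q) ⟨
    map (λ y → k + y ∸ k) (interval 0 q)    ≡⟨ map-cong (m+n∸m≡n k) (interval 0 q) ⟩
    map (λ y → y) (interval 0 q)            ≡⟨ map-id (interval 0 q) ⟩
    interval 0 q ∎

avoider-decomposition : (n : ℕ) {π : List ℕ} → π ↭ interval 0 (suc n) → avoids132 π ≡ true →
  ∃ λ q → ∃ λ c → ∃₂ λ a b → q + c ≡ n × a ↭ interval 0 q × b ↭ interval 0 c × π ≡ joinPerm q c a b
avoider-decomposition n p av with max-split n p
... | u , b , refl , ub↭ with separated-halves n ub↭ (avoider-separated n av ub↭)
... | c , qc , u↭ , b↭ with unshift c (length u) {u} u↭
... | a , refl , a↭ = length u , c , a , b , qc , a↭ , b↭ , cong (λ z → map (c +_) a ++ suc z ∷ b) (sym qc)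

rlmax-joinPerm : (q c : ℕ) {a b : List ℕ} → a ↭ interval 0 q → b ↭ interval 0 c →
  rlmax (joinPerm q c a b) ≡ suc (rlmax b)
rlmax-joinPerm q c {a} {b} pa pb =
  trans (rlmax-before-max (map (c +_) a) L b (joinPerm-left<max q c pa))
        (rlmax-max-∷ L b (joinPerm-right<max q c pb))
  where L = suc (q + c)

des-joinPerm : (q c : ℕ) {a b : List ℕ} → a ↭ interval 0 q → b ↭ interval 0 c →
  des (joinPerm q c a b) ≡ (des a + sign c) + des b
des-joinPerm q c {a} {b} pa pb = begin
  des (A ++ L ∷ b)                       ≡⟨ des-++-∷ A L b ⟩
  des (A ++ [ L ]) + des (L ∷ b)         ≡⟨ cong₂ _+_ (des-∷ʳ-max A L (joinPerm-left<max q c pa))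
                                                      (des-max-∷ L b (joinPerm-right<max q c pb)) ⟩
  des A + (sign (length b) + des b)      ≡⟨ cong₂ (λ x y → x + (sign y + des b)) (des-shift c a) (length-↭interval pb) ⟩
  des a + (sign c + des b)               ≡⟨ +-assoc (des a) (sign c) (des b) ⟨
  (des a + sign c) + des b ∎
  where
  open ≡-Reasoning
  A = map (c +_) a
  L = suc (q + c)

-- All entries are positive, so lis is lisAbove 0, which splits at the separated maximum.
lis-joinPerm : (q c : ℕ) {a b : List ℕ} → a ↭ interval 0 q → b ↭ interval 0 c →
  lis (joinPerm q c a b) ≡ suc (lis a) ⊔ lis b
lis-joinPerm q c {a} {b} pa pb = begin
  lis (A ++ L ∷ b)                               ≡⟨ lis≡lisAbove0 (A ++ L ∷ b) (All-++⁺ posA (s≤s z≤n ∷ posb)) ⟩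
  lisAbove 0 (A ++ L ∷ b)                        ≡⟨ cong (lisAbove 0) (++-assoc A [ L ] b) ⟨
  lisAbove 0 ((A ++ [ L ]) ++ b)                 ≡⟨ lisAbove-++ 0 (A ++ [ L ]) b (joinPerm-separated q c pa pb) ⟩
  lisAbove 0 (A ++ [ L ]) ⊔ lisAbove 0 b         ≡⟨ cong (_⊔ lisAbove 0 b) (lisAbove-∷ʳ-max 0 A L (Allₚ.map proj₂ bounds) (s≤s z≤n)) ⟩
  suc (lisAbove 0 A) ⊔ lisAbove 0 b              ≡⟨ cong (λ z → suc z ⊔ lisAbove 0 b) (lisAbove-raise 0 c A (Allₚ.map proj₁ bounds) z≤n) ⟩
  suc (lisAbove c A) ⊔ lisAbove 0 b              ≡⟨ cong (λ z → suc (lisAbove z A) ⊔ lisAbove 0 b) (+-identityʳ c) ⟨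
  suc (lisAbove (c + 0) A) ⊔ lisAbove 0 b        ≡⟨ cong (λ z → suc z ⊔ lisAbove 0 b) (lisAbove-shift c 0 a) ⟩
  suc (lisAbove 0 a) ⊔ lisAbove 0 b              ≡⟨ cong₂ (λ x y → suc x ⊔ y) (lis≡lisAbove0 a posa) (lis≡lisAbove0 b posb) ⟨
  suc (lis a) ⊔ lis b ∎
  where
  open ≡-Reasoning
  A = map (c +_) a
  L = suc (q + c)
  bounds = joinPerm-left-bounds q c pa
  posA : All (0 <_) A
  posA = Allₚ.map (λ p → ≤-<-trans z≤n (proj₁ p)) bounds
  posa : All (0 <_) a
  posa = Allₚ.tabulate (λ y∈ → proj₁ (∈-↭interval⁻ pa y∈))
  posb : All (0 <_) b
  posb = Allₚ.map proj₁ (joinPerm-right-bounds q c pb)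

Stats : Set
Stats = ℕ × ℕ × ℕ

-- The size argument is unused; it only makes permStats fit the shape of generate-stats.
permStats : ℕ → List ℕ → Stats
permStats _ π = rlmax π , des π , lis π

joinStats : ℕ → ℕ → Stats → Stats → Stats
joinStats q c (ρ , δ , λ₁) (ρ' , δ' , λ') = suc ρ' , (δ + sign c) + δ' , suc λ₁ ⊔ λ'

permStats-join : (q c : ℕ) {a b : List ℕ} → a ↭ interval 0 q → b ↭ interval 0 c →
  permStats (suc (q + c)) (joinPerm q c a b) ≡ joinStats q c (permStats q a) (permStats c b)
permStats-join q c pa pb = cong₂ _,_ (rlmax-joinPerm q c pa pb) (cong₂ _,_ (des-joinPerm q c pa pb) (lis-joinPerm q c pa pb))

increasing : List ℕ → Bool
increasing [] = true
increasing (x ∷ []) = true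
increasing (x ∷ y ∷ s) = (x <ᵇ y) ∧ increasing (y ∷ s)

splitLast-∷ʳ : (ms : List ℕ) (g : ℕ) → splitLast (ms ++ [ g ]) ≡ just (ms , g)
splitLast-∷ʳ [] g = refl
splitLast-∷ʳ (m ∷ ms) g rewrite splitLast-∷ʳ ms g = refl

increasing-tail : (x : ℕ) (t : List ℕ) → increasing (x ∷ t) ≡ true → increasing t ≡ true
increasing-tail x [] p = refl
increasing-tail x (y ∷ t) p = proj₂ (∧-true p)

increasing-head : (l : ℕ) (t : List ℕ) → increasing (l ∷ t) ≡ true → All (l <_) t
increasing-head l [] p = []
increasing-head l (a ∷ t) p with ∧-true p
... | p1 , p2 = <ᵇ-sound p1 ∷ Allₚ.map (<-trans (<ᵇ-sound p1)) (increasing-head a t p2)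

increasing-last : (t : List ℕ) (g : ℕ) → increasing (t ++ [ g ]) ≡ true → All (_< g) t
increasing-last [] g p = []
increasing-last (a ∷ t) g p =
  Allₚ.lookup (increasing-head a (t ++ [ g ]) p) (∈-++⁺ʳ t (here refl)) ∷ increasing-last t g (increasing-tail a (t ++ [ g ]) p)

increasing-cons : (l : ℕ) (t : List ℕ) → All (l <_) t → increasing t ≡ true → increasing (l ∷ t) ≡ true
increasing-cons l [] _ _ = refl
increasing-cons l (a ∷ t) (la ∷ _) p = ∧-intro (<ᵇ-true la) p

-- Above a smaller first entry l, a descent a > b would complete the 132 pattern l a b.
increasing-from-avoid : (l : ℕ) (t : List ℕ) → All (l <_) t → has21Above l t ≡ false → Unique t → increasing t ≡ true
increasing-from-avoid l [] _ _ _ = refl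
increasing-from-avoid l (a ∷ []) _ _ _ = refl
increasing-from-avoid l (a ∷ b ∷ t) (la ∷ lb ∷ ls) h (ua ∷ u) with ∨-false {(l <ᵇ a) ∧ anyᵇ (λ c → (l <ᵇ c) ∧ (c <ᵇ a)) (b ∷ t)} h
... | h1 , h2 = ∧-intro (<ᵇ-true a<b) (increasing-from-avoid l (b ∷ t) (lb ∷ ls) h2 u)
  where
  noMiddle : anyᵇ (λ c → (l <ᵇ c) ∧ (c <ᵇ a)) (b ∷ t) ≡ false
  noMiddle = ∧-false-right (<ᵇ-true la) h1
  b≮a : (b <ᵇ a) ≡ false
  b≮a = ∧-false-right (<ᵇ-true lb) (proj₁ (∨-false {(l <ᵇ b) ∧ (b <ᵇ a)} noMiddle))
  a<b : a < b
  a<b with <-cmp a b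
  ... | tri< x _ _ = x
  ... | tri≈ _ e _ = ⊥-elim (Allₚ.lookup ua (here refl) e)
  ... | tri> _ _ x = ⊥-elim (true≢false (trans (sym (<ᵇ-true x)) b≮a))

least<greatest : (l g : ℕ) (ms : List ℕ) → ms ≢ [] → All (λ m → ((l <ᵇ m) ∧ (m <ᵇ g)) ≡ true) ms → l < g
least<greatest l g [] ne _ = ⊥-elim (ne refl)
least<greatest l g (m ∷ _) _ (e ∷ _) = <-trans (<ᵇ-sound (proj₁ (∧-true e))) (<ᵇ-sound (proj₂ (∧-true {l <ᵇ m} e)))

diamondOK≡increasing : (l : ℕ) (ms : List ℕ) (g : ℕ) → ms ≢ [] → avoids132 (l ∷ ms ++ [ g ]) ≡ true → Unique (l ∷ ms ++ [ g ]) →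
  diamondOK (l ∷ ms ++ [ g ]) ≡ increasing (l ∷ ms ++ [ g ])
diamondOK≡increasing l ms g ne av (_ ∷ u) rewrite splitLast-∷ʳ ms g = bool-ext to from
  where
  between = λ m → (l <ᵇ m) ∧ (m <ᵇ g)
  to : allᵇ between ms ≡ true → increasing (l ∷ ms ++ [ g ]) ≡ true
  to a = increasing-cons l (ms ++ [ g ]) above (increasing-from-avoid l (ms ++ [ g ]) above (not-true (proj₁ (∧-true av))) u)
    where
    inside = allᵇ-sound between ms a
    above : All (l <_) (ms ++ [ g ])
    above = All-++⁺ (Allₚ.map (λ e → <ᵇ-sound (proj₁ (∧-true e))) inside) (least<greatest l g ms ne inside ∷ [])
  from : increasing (l ∷ ms ++ [ g ]) ≡ true → allᵇ between ms ≡ true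
  from p = allᵇ-true ms (Allₚ.zipWith (λ (x , y) → ∧-intro (<ᵇ-true x) (<ᵇ-true y))
    (Allₚ.tabulate (λ m → Allₚ.lookup (increasing-head l (ms ++ [ g ]) p) (∈-++⁺ˡ m)) ,
     increasing-last ms g (increasing-tail l (ms ++ [ g ]) p)))

norths : List Step → ℕ
norths [] = 0
norths (E ∷ s) = norths s
norths (N ∷ s) = suc (norths s)

easts : List Step → ℕ
easts [] = 0
easts (E ∷ s) = suc (easts s)
easts (N ∷ s) = easts s

norths-++ : (b t : List Step) → norths (b ++ t) ≡ norths b + norths t
norths-++ [] t = refl
norths-++ (E ∷ b) t = norths-++ b t
norths-++ (N ∷ b) t = cong suc (norths-++ b t)

noSteps : (s : List Step) → easts s ≡ 0 → norths s ≡ 0 → s ≡ []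
noSteps [] _ _ = refl
noSteps (E ∷ s) () _
noSteps (N ∷ s) _ ()

norths-closing : (a : List Step) → norths (a ++ [ N ]) ≡ suc (norths a)
norths-closing a = trans (norths-++ a [ N ]) (+-comm (norths a) 1)

norths-returning : (a b : List Step) → norths (b ++ E ∷ a ++ [ N ]) ≡ suc (norths a + norths b)
norths-returning a b =
  trans (norths-++ b (E ∷ a ++ [ N ])) (trans (cong (norths b +_) (norths-closing a)) (+-comm (norths b) (suc (norths a))))

corners-∷ʳN : (s : List Step) → corners (s ++ [ N ]) ≡ corners s
corners-∷ʳN [] = refl
corners-∷ʳN (E ∷ s) = corners-∷ʳN s
corners-∷ʳN (N ∷ []) = refl
corners-∷ʳN (N ∷ E ∷ s) = cong suc (corners-∷ʳN (E ∷ s))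
corners-∷ʳN (N ∷ N ∷ s) = corners-∷ʳN (N ∷ s)

endsNorth : List Step → ℕ
endsNorth [] = 0
endsNorth (E ∷ []) = 0
endsNorth (N ∷ []) = 1
endsNorth (x ∷ y ∷ s) = endsNorth (y ∷ s)

corners-++E : (s t : List Step) → corners (s ++ E ∷ t) ≡ corners s + endsNorth s + corners t
corners-++E [] t = refl
corners-++E (E ∷ []) t = refl
corners-++E (N ∷ []) t = refl
corners-++E (E ∷ y ∷ s) t = corners-++E (y ∷ s) t
corners-++E (N ∷ E ∷ s) t = cong suc (corners-++E (E ∷ s) t)
corners-++E (N ∷ N ∷ s) t = corners-++E (N ∷ s) t

∈-words⁻ : (e n : ℕ) {s : List Step} → s ∈ words e n → easts s ≡ e × norths s ≡ n
∈-words⁻ zero zero (here refl) = refl , refl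
∈-words⁻ (suc e) zero m with ∈-map⁻ (E ∷_) m
... | s' , m' , refl = cong suc (proj₁ (∈-words⁻ e zero m')) , proj₂ (∈-words⁻ e zero m')
∈-words⁻ zero (suc n) m with ∈-map⁻ (N ∷_) m
... | s' , m' , refl = proj₁ (∈-words⁻ zero n m') , cong suc (proj₂ (∈-words⁻ zero n m'))
∈-words⁻ (suc e) (suc n) m with ∈-++⁻ (map (E ∷_) (words e (suc n))) m
... | inj₁ m1 with ∈-map⁻ (E ∷_) m1
...   | s' , m' , refl = cong suc (proj₁ (∈-words⁻ e (suc n) m')) , proj₂ (∈-words⁻ e (suc n) m')
∈-words⁻ (suc e) (suc n) m | inj₂ m2 with ∈-map⁻ (N ∷_) m2
...   | s' , m' , refl = proj₁ (∈-words⁻ (suc e) n m') , cong suc (proj₂ (∈-words⁻ (suc e) n m'))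

∈-words⁺ : (s : List Step) → s ∈ words (easts s) (norths s)
∈-words⁺ [] = here refl
∈-words⁺ (E ∷ s) with norths s in eq
... | zero = ∈-map⁺ (E ∷_) (subst (λ z → s ∈ words (easts s) z) eq (∈-words⁺ s))
... | suc k = ∈-++⁺ˡ (∈-map⁺ (E ∷_) (subst (λ z → s ∈ words (easts s) z) eq (∈-words⁺ s)))
∈-words⁺ (N ∷ s) with easts s in eq
... | zero = ∈-map⁺ (N ∷_) (subst (λ z → s ∈ words z (norths s)) eq (∈-words⁺ s))
... | suc k = ∈-++⁺ʳ (map (E ∷_) (words k (suc (norths s)))) (∈-map⁺ (N ∷_) (subst (λ z → s ∈ words z (norths s)) eq (∈-words⁺ s)))

words-unique : (e n : ℕ) → Unique (words e n)
words-unique zero zero = [] ∷ []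
words-unique (suc e) zero = Uniqueₚ.map⁺ ∷-injectiveʳ (words-unique e zero)
words-unique zero (suc n) = Uniqueₚ.map⁺ ∷-injectiveʳ (words-unique zero n)
words-unique (suc e) (suc n) = Uniqueₚ.++⁺ (Uniqueₚ.map⁺ ∷-injectiveʳ (words-unique e (suc n))) (Uniqueₚ.map⁺ ∷-injectiveʳ (words-unique (suc e) n)) disj
  where
  disj : ∀ {z} → z ∈ map (E ∷_) (words e (suc n)) × z ∈ map (N ∷_) (words (suc e) n) → ⊥
  disj (m1 , m2) with ∈-map⁻ (E ∷_) m1 | ∈-map⁻ (N ∷_) m2
  ... | _ , _ , refl | _ , _ , ()

module _ (w : ℕ) where

  v : ℕ
  v = suc w

  -- residue n is n mod v, computed without division.
  residueStep : ℕ → ℕ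
  residueStep r = if r ≡ᵇ w then 0 else suc r

  residue : ℕ → ℕ
  residue zero = 0
  residue (suc n) = residueStep (residue n)

  -- Position i (counted from 0) is the last one of its block of v consecutive positions.
  blockEnd : ℕ → Bool
  blockEnd i = residue (suc i) ≡ᵇ 0

  residueStep≡0 : {r : ℕ} → residueStep r ≡ 0 → r ≡ w
  residueStep≡0 {r} e with r ≡ᵇ w in eq
  ... | true = ≡ᵇ-sound eq
  ... | false = ⊥-elim (0≢1+n (sym e))

  residueStep-≢ : {r : ℕ} → r ≢ w → residueStep r ≡ suc r
  residueStep-≢ {r} ne rewrite ≡ᵇ-false ne = refl

  residueStep-w : residueStep w ≡ 0
  residueStep-w rewrite ≡ᵇ-refl w = refl

  residue-+ˡ : (m n : ℕ) → residue n ≡ 0 → residue (m + n) ≡ residue m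
  residue-+ˡ zero n e = e
  residue-+ˡ (suc m) n e = cong residueStep (residue-+ˡ m n e)

  residue-+ʳ : (m n : ℕ) → residue m ≡ 0 → residue (m + n) ≡ residue n
  residue-+ʳ m zero e = trans (cong residue (+-identityʳ m)) e
  residue-+ʳ m (suc n) e = trans (cong residue (+-suc m n)) (cong residueStep (residue-+ʳ m n e))

  residue-small : (n : ℕ) → n ≤ w → residue n ≡ n
  residue-small zero _ = refl
  residue-small (suc n) p rewrite residue-small n (<⇒≤ p) = residueStep-≢ (λ e → <-irrefl e p)

  residue-v : residue v ≡ 0
  residue-v rewrite residue-small w ≤-refl = residueStep-w

  residue-multiple : (d : ℕ) → residue (v * d) ≡ 0
  residue-multiple zero = cong residue (*-zeroʳ v)
  residue-multiple (suc d) = trans (cong residue (*-suc v d)) (trans (residue-+ˡ v (v * d) (residue-multiple d)) residue-v)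

  blockEnd⇒residue : {i : ℕ} → blockEnd i ≡ true → residue (suc i) ≡ 0
  blockEnd⇒residue e = ≡ᵇ-sound e

  blockEnd-shift : (m i : ℕ) → residue m ≡ 0 → blockEnd (m + i) ≡ blockEnd i
  blockEnd-shift m i e = cong (_≡ᵇ 0) (trans (cong residue (sym (+-suc m i))) (residue-+ʳ m (suc i) e))

  -- blockIncr i π: the word π, placed from position i on, increases inside every block.
  blockIncr : ℕ → List ℕ → Bool
  blockIncr i [] = true
  blockIncr i (x ∷ []) = true
  blockIncr i (x ∷ y ∷ xs) = (blockEnd i ∨ (x <ᵇ y)) ∧ blockIncr (suc i) (y ∷ xs)

  blockIncr-prefix : (i : ℕ) (xs ys : List ℕ) → blockIncr i (xs ++ ys) ≡ true → blockIncr i xs ≡ true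
  blockIncr-prefix i [] ys p = refl
  blockIncr-prefix i (x ∷ []) ys p = refl
  blockIncr-prefix i (x ∷ x' ∷ xs) ys p =
    ∧-intro (proj₁ (∧-true p)) (blockIncr-prefix (suc i) (x' ∷ xs) ys (proj₂ (∧-true {blockEnd i ∨ (x <ᵇ x')} p)))

  blockIncr-tail : (i : ℕ) (x : ℕ) (ys : List ℕ) → blockIncr i (x ∷ ys) ≡ true → blockIncr (suc i) ys ≡ true
  blockIncr-tail i x [] p = refl
  blockIncr-tail i x (y ∷ ys) p = proj₂ (∧-true p)

  blockIncr-drop : (i : ℕ) (xs ys : List ℕ) → blockIncr i (xs ++ ys) ≡ true → blockIncr (i + length xs) ys ≡ true
  blockIncr-drop i [] ys p = subst (λ z → blockIncr z ys ≡ true) (sym (+-identityʳ i)) p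
  blockIncr-drop i (x ∷ xs) ys p =
    subst (λ z → blockIncr z ys ≡ true) (sym (+-suc i (length xs))) (blockIncr-drop (suc i) xs ys (blockIncr-tail i x (xs ++ ys) p))

  blockIncr-shiftBlocks : (m i : ℕ) (xs : List ℕ) → residue m ≡ 0 → blockIncr (m + i) xs ≡ blockIncr i xs
  blockIncr-shiftBlocks m i [] e = refl
  blockIncr-shiftBlocks m i (x ∷ []) e = refl
  blockIncr-shiftBlocks m i (x ∷ y ∷ xs) e =
    cong₂ (λ a b → (a ∨ (x <ᵇ y)) ∧ b) (blockEnd-shift m i e)
          (trans (cong (λ z → blockIncr z (y ∷ xs)) (sym (+-suc m i))) (blockIncr-shiftBlocks m (suc i) (y ∷ xs) e))

  blockIncr-afterEnd : (i : ℕ) (xs : List ℕ) → blockEnd i ≡ true → blockIncr (suc i) xs ≡ blockIncr 0 xs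
  blockIncr-afterEnd i xs e =
    trans (cong (λ z → blockIncr z xs) (sym (+-identityʳ (suc i)))) (blockIncr-shiftBlocks (suc i) 0 xs (blockEnd⇒residue {i} e))

  blockIncr-shift : (c i : ℕ) (xs : List ℕ) → blockIncr i (map (c +_) xs) ≡ blockIncr i xs
  blockIncr-shift c i [] = refl
  blockIncr-shift c i (x ∷ []) = refl
  blockIncr-shift c i (x ∷ y ∷ xs) = cong₂ (λ a b → (blockEnd i ∨ a) ∧ b) (<ᵇ-shift c x y) (blockIncr-shift c (suc i) (y ∷ xs))

  blockIncr-descent : (i m y : ℕ) (b : List ℕ) → blockIncr i (m ∷ y ∷ b) ≡ true → y < m → blockEnd i ≡ true
  blockIncr-descent i m y b p ym with ∧-true p
  ... | p1 , _ with ∨-true p1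
  ... | inj₁ q = q
  ... | inj₂ q = ⊥-elim (<-asym ym (<ᵇ-sound q))

  blockIncr-cons : (i m : ℕ) (b : List ℕ) → (blockEnd i ≡ true ⊎ b ≡ []) → blockIncr 0 b ≡ true → blockIncr i (m ∷ b) ≡ true
  blockIncr-cons i m [] _ _ = refl
  blockIncr-cons i m (y ∷ b) (inj₁ e) p =
    ∧-intro (∨-introˡ e) (trans (blockIncr-afterEnd i (y ∷ b) e) p)

  blockIncr-join : (i : ℕ) (A : List ℕ) (m : ℕ) (b : List ℕ) → blockIncr i A ≡ true → All (_< m) A →
    (blockEnd (i + length A) ≡ true ⊎ b ≡ []) → blockIncr 0 b ≡ true → blockIncr i (A ++ m ∷ b) ≡ true
  blockIncr-join i [] m b _ _ e p = blockIncr-cons i m b (subst (λ z → blockEnd z ≡ true ⊎ b ≡ []) (+-identityʳ i) e) p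
  blockIncr-join i (x ∷ []) m b _ (q ∷ _) e p =
    ∧-intro (trans (cong (blockEnd i ∨_) (<ᵇ-true q)) (∨-zeroʳ (blockEnd i)))
      (blockIncr-join (suc i) [] m b refl [] (subst (λ z → blockEnd z ≡ true ⊎ b ≡ []) (+-suc i 0) e) p)
  blockIncr-join i (x ∷ x' ∷ A) m b a (q ∷ qs) e p =
    ∧-intro (proj₁ (∧-true a))
      (blockIncr-join (suc i) (x' ∷ A) m b (proj₂ (∧-true {blockEnd i ∨ (x <ᵇ x')} a)) qs
        (subst (λ z → blockEnd z ≡ true ⊎ b ≡ []) (+-suc i (suc (length A))) e) p)

  residue-blockEnd : (q : ℕ) → blockEnd q ≡ true → residue q ≡ w
  residue-blockEnd q e = residueStep≡0 (blockEnd⇒residue {q} e)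

  residue-after-blockEnd : (q c : ℕ) → blockEnd q ≡ true → residue (suc (q + c)) ≡ residue c
  residue-after-blockEnd q c e = residue-+ʳ (suc q) c (blockEnd⇒residue {q} e)

  residue-suc : (q : ℕ) → blockEnd q ≡ false → residue (suc q) ≡ suc (residue q)
  residue-suc q e with residue q ≟ w
  ... | yes r≡w = ⊥-elim (true≢false (trans (sym (cong (_≡ᵇ 0) (trans (cong residueStep r≡w) residueStep-w))) e))
  ... | no r≢w = residueStep-≢ r≢w

  residueStep≡suc : {r t : ℕ} → residueStep r ≡ suc t → r ≡ t
  residueStep≡suc {r} e with r ≡ᵇ w
  ... | true = ⊥-elim (0≢1+n e)
  ... | false = suc-injective e

  -- The maximum of a block-increasing word, at position q, ends a block unless nothing follows it.
  admissible : ℕ × ℕ → Bool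
  admissible (q , c) = blockEnd q ∨ (c ≡ᵇ 0)

  open Generation admissible

  admissible⁻ : (q c : ℕ) → admissible (q , c) ≡ true → blockEnd q ≡ true ⊎ c ≡ 0
  admissible⁻ q c ok with ∨-true {blockEnd q} ok
  ... | inj₁ e = inj₁ e
  ... | inj₂ e = inj₂ (≡ᵇ-sound e)

  admissible⁺ : (q c : ℕ) → blockEnd q ≡ true ⊎ c ≡ 0 → admissible (q , c) ≡ true
  admissible⁺ q c (inj₁ e) = ∨-introˡ e
  admissible⁺ q .0 (inj₂ refl) = ∨-zeroʳ (blockEnd q)

  admissible-notBlockEnd : (q c : ℕ) → blockEnd q ≡ false → admissible (q , c) ≡ true → c ≡ 0
  admissible-notBlockEnd q c e ok with admissible⁻ q c ok
  ... | inj₁ e' = ⊥-elim (true≢false (trans (sym e') e))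
  ... | inj₂ c≡0 = c≡0

  BlockPerm : ℕ → List ℕ → Set
  BlockPerm L π = (π ↭ interval 0 L) × (blockIncr 0 π ≡ true) × (avoids132 π ≡ true)

  perms : ℕ → ℕ → List (List ℕ)
  perms = generate joinPerm []

  blockIncr-after-max : (q m : ℕ) (b : List ℕ) → All (_< m) b → blockIncr q (m ∷ b) ≡ true →
    blockIncr 0 b ≡ true × (blockEnd q ≡ true ⊎ b ≡ [])
  blockIncr-after-max q m [] _ _ = refl , inj₂ refl
  blockIncr-after-max q m (y ∷ b) (y<m ∷ _) bi = restart , inj₁ end
    where
    end : blockEnd q ≡ true
    end = blockIncr-descent q m y b bi y<m
    restart : blockIncr 0 (y ∷ b) ≡ true
    restart = trans (sym (blockIncr-afterEnd q (y ∷ b) end)) (blockIncr-tail q m (y ∷ b) bi)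

  joinPerm-blockIncr⁺ : (q c : ℕ) {a b : List ℕ} → a ↭ interval 0 q → b ↭ interval 0 c →
    admissible (q , c) ≡ true → blockIncr 0 a ≡ true → blockIncr 0 b ≡ true → blockIncr 0 (joinPerm q c a b) ≡ true
  joinPerm-blockIncr⁺ q c {a} {b} pa pb ok ba bb =
    blockIncr-join 0 (map (c +_) a) (suc (q + c)) b (trans (blockIncr-shift c 0 a) ba)
      (joinPerm-left<max q c pa) maxEndsBlock bb
    where
    maxEndsBlock : blockEnd (length (map (c +_) a)) ≡ true ⊎ b ≡ []
    maxEndsBlock with admissible⁻ q c ok
    ... | inj₁ e = inj₁ (subst (λ i → blockEnd i ≡ true) (sym (trans (length-map (c +_) a) (length-↭interval pa))) e)
    ... | inj₂ c≡0 = inj₂ (length≡0 b (trans (length-↭interval pb) c≡0))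

  joinPerm-blockIncr⁻ : (q c : ℕ) {a b : List ℕ} → a ↭ interval 0 q → b ↭ interval 0 c →
    blockIncr 0 (joinPerm q c a b) ≡ true → blockIncr 0 a ≡ true × blockIncr 0 b ≡ true × admissible (q , c) ≡ true
  joinPerm-blockIncr⁻ q c {a} {b} pa pb bi with blockIncr-after-max q (suc (q + c)) b b<max atMax
    where
    b<max : All (_< suc (q + c)) b
    b<max = joinPerm-right<max q c pb
    atMax : blockIncr q (suc (q + c) ∷ b) ≡ true
    atMax = subst (λ i → blockIncr i (suc (q + c) ∷ b) ≡ true) (trans (length-map (c +_) a) (length-↭interval pa))
                  (blockIncr-drop 0 (map (c +_) a) (suc (q + c) ∷ b) bi)
  ... | bb , endOrEmpty = left , bb , admissible⁺ q c (map₂ (λ e → trans (sym (length-↭interval pb)) (cong length e)) endOrEmpty)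
    where
    left : blockIncr 0 a ≡ true
    left = trans (sym (blockIncr-shift c 0 a)) (blockIncr-prefix 0 (map (c +_) a) (suc (q + c) ∷ b) bi)

  perms-sound : {f L : ℕ} {π : List ℕ} → π ∈ perms f L → BlockPerm L π
  perms-sound {suc f} {zero} (here refl) = ↭.refl , refl , refl
  perms-sound {suc f} {suc n} m with ∈-generate⁻ joinPerm [] {f} {n} m
  ... | q , c , a , b , qc∈ , a∈ , b∈ , refl with perms-sound {f} {q} a∈ | perms-sound {f} {c} b∈ | ∈-admissibleSplits⁻ {n} {q} {c} qc∈
  ... | pa , ba , va | pb , bb , vb | refl , ok =
    joinPerm-↭ q c pa pb , joinPerm-blockIncr⁺ q c pa pb ok ba bb , trans (joinPerm-avoids q c pa pb) (∧-intro va vb)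

  perms-complete : (f L : ℕ) → L < f → (π : List ℕ) → BlockPerm L π → π ∈ perms f L
  perms-complete (suc f) zero _ π (p , _ , _) rewrite ↭-empty-inv p = here refl
  perms-complete (suc f) (suc n) (s≤s L≤f) π (p , bπ , aπ) with avoider-decomposition n p aπ
  ... | q , c , a , b , refl , pa , pb , refl
    with joinPerm-blockIncr⁻ q c pa pb bπ | ∧-true (trans (sym (joinPerm-avoids q c pa pb)) aπ)
  ... | ba , bb , ok | va , vb =
    ∈-generate⁺ joinPerm [] {f} {q + c} (∈-admissibleSplits⁺ refl ok)
      (perms-complete f q (<-≤-trans (s≤s (m≤m+n q c)) L≤f) a (pa , ba , va))
      (perms-complete f c (<-≤-trans (s≤s (m≤n+m c q)) L≤f) b (pb , bb , vb))

  -- The slack of a point (x , y) is v x − y.  slackRun σ s follows it along s from slack σ,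
  -- and is nothing as soon as s crosses the line y = v x.
  slackRun : ℕ → List Step → Maybe ℕ
  slackRun σ [] = just σ
  slackRun σ (E ∷ s) = slackRun (σ + v) s
  slackRun zero (N ∷ s) = nothing
  slackRun (suc σ) (N ∷ s) = slackRun σ s

  isZero : ℕ → ℕ
  isZero σ = if σ ≡ᵇ 0 then 1 else 0

  zeroSlacks : ℕ → List Step → ℕ
  zeroSlacks σ [] = 0
  zeroSlacks σ (E ∷ s) = isZero σ + zeroSlacks (σ + v) s
  zeroSlacks σ (N ∷ s) = isZero σ + zeroSlacks (pred σ) s

  slacks : ℕ → List Step → List ℕ
  slacks σ [] = σ ∷ []
  slacks σ (E ∷ s) = σ ∷ slacks (σ + v) s
  slacks σ (N ∷ s) = σ ∷ slacks (pred σ) s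

  slackRun-++ : (σ : ℕ) (b t : List Step) {σ' : ℕ} → slackRun σ b ≡ just σ' → slackRun σ (b ++ t) ≡ slackRun σ' t
  slackRun-++ σ [] t refl = refl
  slackRun-++ σ (E ∷ b) t p = slackRun-++ (σ + v) b t p
  slackRun-++ (suc σ) (N ∷ b) t p = slackRun-++ σ b t p

  slackRun-++⁻ : (σ : ℕ) (b t : List Step) {τ : ℕ} → slackRun σ (b ++ t) ≡ just τ → ∃ λ σ' → slackRun σ b ≡ just σ'
  slackRun-++⁻ σ [] t p = σ , refl
  slackRun-++⁻ σ (E ∷ b) t p = slackRun-++⁻ (σ + v) b t p
  slackRun-++⁻ (suc σ) (N ∷ b) t p = slackRun-++⁻ σ b t p

  slackRun-suc : (σ : ℕ) (s : List Step) {τ : ℕ} → slackRun σ s ≡ just τ → slackRun (suc σ) s ≡ just (suc τ)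
  slackRun-suc σ [] refl = refl
  slackRun-suc σ (E ∷ s) p = slackRun-suc (σ + v) s p
  slackRun-suc (suc σ) (N ∷ s) p = slackRun-suc σ s p

  slackRun-pred : (σ : ℕ) (s : List Step) {τ : ℕ} → slackRun (suc σ) s ≡ just (suc τ) → zeroSlacks (suc σ) s ≡ 0 → slackRun σ s ≡ just τ
  slackRun-pred σ [] refl _ = refl
  slackRun-pred σ (E ∷ s) p z = slackRun-pred (σ + v) s p z
  slackRun-pred zero (N ∷ []) () z
  slackRun-pred zero (N ∷ E ∷ s) p ()
  slackRun-pred zero (N ∷ N ∷ s) p ()
  slackRun-pred (suc σ) (N ∷ s) p z = slackRun-pred σ s p z

  slackRun-conservation : (σ : ℕ) (s : List Step) {τ : ℕ} → slackRun σ s ≡ just τ → τ + norths s ≡ σ + easts s * v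
  slackRun-conservation σ [] refl = trans (+-identityʳ σ) (sym (+-identityʳ σ))
  slackRun-conservation σ (E ∷ s) p = trans (slackRun-conservation (σ + v) s p) (trans (+-assoc σ v (easts s * v)) refl)
  slackRun-conservation (suc σ) (N ∷ s) {τ} p = trans (+-suc τ (norths s)) (cong suc (slackRun-conservation σ s p))

  zeroSlacks-++ : (σ : ℕ) (b t : List Step) {σ' : ℕ} → slackRun σ b ≡ just σ' → zeroSlacks σ (b ++ t) ≡ zeroSlacks σ b + zeroSlacks σ' t
  zeroSlacks-++ σ [] t refl = refl
  zeroSlacks-++ σ (E ∷ b) t p = trans (cong (isZero σ +_) (zeroSlacks-++ (σ + v) b t p)) (sym (+-assoc (isZero σ) _ _))
  zeroSlacks-++ (suc σ) (N ∷ b) t p = zeroSlacks-++ σ b t p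

  zeroSlacks-suc : (σ : ℕ) (s : List Step) {τ : ℕ} → slackRun σ s ≡ just τ → zeroSlacks (suc σ) s ≡ 0
  zeroSlacks-suc σ [] p = refl
  zeroSlacks-suc σ (E ∷ s) p = zeroSlacks-suc (σ + v) s p
  zeroSlacks-suc (suc σ) (N ∷ s) p = zeroSlacks-suc σ s p

  slacks-suc : (σ : ℕ) (s : List Step) {τ : ℕ} → slackRun σ s ≡ just τ → slacks (suc σ) s ≡ map suc (slacks σ s)
  slacks-suc σ [] p = refl
  slacks-suc σ (E ∷ s) p = cong (suc σ ∷_) (slacks-suc (σ + v) s p)
  slacks-suc (suc σ) (N ∷ s) p = cong (suc (suc σ) ∷_) (slacks-suc σ s p)

  slacks-head : (σ : ℕ) (s : List Step) → σ ≤ maxList (slacks σ s)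
  slacks-head σ [] = m≤m⊔n σ 0
  slacks-head σ (E ∷ s) = m≤m⊔n σ _
  slacks-head σ (N ∷ s) = m≤m⊔n σ _

  slacks-++ : (σ : ℕ) (b t : List Step) {σ' : ℕ} → slackRun σ b ≡ just σ' →
    maxList (slacks σ (b ++ t)) ≡ maxList (slacks σ b) ⊔ maxList (slacks σ' t)
  slacks-++ σ [] t refl = sym (trans (cong (_⊔ maxList (slacks σ t)) (⊔-identityʳ σ)) (m≤n⇒m⊔n≡n (slacks-head σ t)))
  slacks-++ σ (E ∷ b) t {σ'} p = trans (cong (σ ⊔_) (slacks-++ (σ + v) b t p)) (sym (⊔-assoc σ (maxList (slacks (σ + v) b)) (maxList (slacks σ' t))))
  slacks-++ (suc σ) (N ∷ b) t {σ'} p = trans (cong (suc σ ⊔_) (slacks-++ σ b t p)) (sym (⊔-assoc (suc σ) (maxList (slacks σ b)) (maxList (slacks σ' t))))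

  slacks-nonEmpty : (σ : ℕ) (s : List Step) → slacks σ s ≢ []
  slacks-nonEmpty σ [] ()
  slacks-nonEmpty σ (E ∷ s) ()
  slacks-nonEmpty σ (N ∷ s) ()

  slackRun-closing : (σ : ℕ) (a : List Step) → slackRun σ a ≡ just 0 → slackRun (suc σ) (a ++ [ N ]) ≡ just 0
  slackRun-closing σ a r = slackRun-++ (suc σ) a [ N ] (slackRun-suc σ a r)

  -- Paths of size L: they start at slack (L mod v) and end at slack 0 after L north steps.
  -- For L = v d this is Dyck_{v,d}; the smaller sizes occur as pieces of such paths.
  SlackPath : ℕ → List Step → Set
  SlackPath L s = (slackRun (residue L) s ≡ just 0) × (norths s ≡ L)

  SlackPath-zero : {s : List Step} → SlackPath 0 s → s ≡ []
  SlackPath-zero {s} (r , n) = noSteps s e n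
    where
    e : easts s ≡ 0
    e with easts s in eq
    ... | zero = refl
    ... | suc k = ⊥-elim (0≢1+n (trans (trans (sym (cong (0 +_) n)) (slackRun-conservation 0 s r)) (cong (_* v) eq)))

  endsNorth-returning : (σ : ℕ) (s : List Step) → slackRun σ s ≡ just 0 → s ≢ [] → endsNorth s ≡ 1
  endsNorth-returning σ [] p ne = ⊥-elim (ne refl)
  endsNorth-returning σ (E ∷ []) p ne = ⊥-elim (0≢1+n (trans (sym (just-injective p)) (+-suc σ w)))
  endsNorth-returning (suc σ) (N ∷ []) p ne = refl
  endsNorth-returning σ (E ∷ y ∷ s) p ne = endsNorth-returning (σ + v) (y ∷ s) p (λ ())
  endsNorth-returning (suc σ) (N ∷ y ∷ s) p ne = endsNorth-returning σ (y ∷ s) p (λ ())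

  endsNorth-sign : {c : ℕ} {b : List Step} → SlackPath c b → endsNorth b ≡ sign c
  endsNorth-sign {zero} {b} vb = cong endsNorth (SlackPath-zero {b} vb)
  endsNorth-sign {suc c} {b} (r , n) = endsNorth-returning (residue (suc c)) b r (λ e → 0≢1+n (trans (sym (cong norths e)) n))

  -- Mirror image of joinPerm: if q ends a block, the left part a becomes an excursion E a N lifted
  -- one step above the line, placed after b; otherwise c = 0 and a is closed by one north step.
  joinPath : ℕ → ℕ → List Step → List Step → List Step
  joinPath q c a b = if blockEnd q then b ++ E ∷ a ++ [ N ] else a ++ [ N ]

  paths : ℕ → ℕ → List (List Step)
  paths = generate joinPath []

  joinPath-returning≡ : (q c : ℕ) (a b : List Step) → blockEnd q ≡ true → joinPath q c a b ≡ b ++ E ∷ a ++ [ N ]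
  joinPath-returning≡ q c a b e = cong (λ z → if z then b ++ E ∷ a ++ [ N ] else a ++ [ N ]) e

  joinPath-closing≡ : (q c : ℕ) (a b : List Step) → blockEnd q ≡ false → joinPath q c a b ≡ a ++ [ N ]
  joinPath-closing≡ q c a b e = cong (λ z → if z then b ++ E ∷ a ++ [ N ] else a ++ [ N ]) e

  joinPath-returning : {q c : ℕ} {a b : List Step} → blockEnd q ≡ true → SlackPath q a → SlackPath c b →
    SlackPath (suc (q + c)) (b ++ E ∷ a ++ [ N ])
  joinPath-returning {q} {c} {a} {b} e (ra , refl) (rb , refl) = run , norths-returning a b
    where
    a-from-w : slackRun w a ≡ just 0
    a-from-w = subst (λ σ → slackRun σ a ≡ just 0) (residue-blockEnd q e) ra
    run : slackRun (residue (suc (q + c))) (b ++ E ∷ a ++ [ N ]) ≡ just 0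
    run = trans (cong (λ σ → slackRun σ (b ++ E ∷ a ++ [ N ])) (residue-after-blockEnd q c e))
            (trans (slackRun-++ (residue c) b (E ∷ a ++ [ N ]) rb) (slackRun-closing w a a-from-w))

  joinPath-closing : {q : ℕ} {a : List Step} → blockEnd q ≡ false → SlackPath q a → SlackPath (suc (q + 0)) (a ++ [ N ])
  joinPath-closing {q} {a} e (ra , refl) = run , trans (norths-closing a) (cong suc (sym (+-identityʳ (norths a))))
    where
    run : slackRun (residue (suc (q + 0))) (a ++ [ N ]) ≡ just 0
    run = trans (cong (λ σ → slackRun σ (a ++ [ N ])) (trans (cong (λ z → residue (suc z)) (+-identityʳ q)) (residue-suc q e)))
            (slackRun-closing (residue q) a ra)

  paths-sound : {f L : ℕ} {s : List Step} → s ∈ paths f L → SlackPath L s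
  paths-sound {suc f} {zero} (here refl) = refl , refl
  paths-sound {suc f} {suc n} m with ∈-generate⁻ joinPath [] {f} {n} m
  ... | q , c , a , b , qc∈ , a∈ , b∈ , refl with paths-sound {f} {q} a∈ | paths-sound {f} {c} b∈ | ∈-admissibleSplits⁻ {n} {q} {c} qc∈
  ... | va | vb | refl , ok with blockEnd q in e
  ... | true = joinPath-returning {q} {c} {a} {b} e va vb
  ... | false with ≡ᵇ-sound {c} {0} ok
  ... | refl with SlackPath-zero {b} vb
  ... | refl = joinPath-closing {q} {a} e va

  pathStats : ℕ → List Step → Stats
  pathStats L s = zeroSlacks (residue L) s + sign (residue L) , corners s , maxList (slacks (residue L) s)

  zeroSlacks-closing : (σ : ℕ) (a : List Step) → slackRun σ a ≡ just 0 → zeroSlacks (suc σ) (a ++ [ N ]) ≡ 0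
  zeroSlacks-closing σ a r = trans (zeroSlacks-++ (suc σ) a [ N ] (slackRun-suc σ a r)) (cong (_+ 0) (zeroSlacks-suc σ a r))

  maxSlack-closing : (σ : ℕ) (a : List Step) → slackRun σ a ≡ just 0 → maxList (slacks (suc σ) (a ++ [ N ])) ≡ suc (maxList (slacks σ a))
  maxSlack-closing σ a r = trans (slacks-++ (suc σ) a [ N ] (slackRun-suc σ a r))
    (trans (cong (_⊔ 1) (trans (cong maxList (slacks-suc σ a r)) (maxList-map-suc (slacks σ a) (slacks-nonEmpty σ a))))
      (cong suc (⊔-identityʳ (maxList (slacks σ a)))))

  pathStats-returning : {q c : ℕ} {a b : List Step} → blockEnd q ≡ true → SlackPath q a → SlackPath c b →
    pathStats (suc (q + c)) (b ++ E ∷ a ++ [ N ]) ≡ joinStats q c (pathStats q a) (pathStats c b)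
  pathStats-returning {q} {c} {a} {b} e (ra , _) vb@(rb , _) = cong₂ _,_ touch (cong₂ _,_ corner high)
    where
    σ = residue (suc (q + c))
    σ≡ : σ ≡ residue c
    σ≡ = residue-after-blockEnd q c e
    a-from-w : slackRun w a ≡ just 0
    a-from-w = subst (λ z → slackRun z a ≡ just 0) (residue-blockEnd q e) ra
    b-from-σ : slackRun σ b ≡ just 0
    b-from-σ = subst (λ z → slackRun z b ≡ just 0) (sym σ≡) rb
    touch : zeroSlacks σ (b ++ E ∷ a ++ [ N ]) + sign σ ≡ suc (zeroSlacks (residue c) b + sign (residue c))
    touch = begin
      zeroSlacks σ (b ++ E ∷ a ++ [ N ]) + sign σ            ≡⟨ cong (_+ sign σ) (zeroSlacks-++ σ b (E ∷ a ++ [ N ]) b-from-σ) ⟩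
      zeroSlacks σ b + suc (zeroSlacks v (a ++ [ N ])) + sign σ
                                                              ≡⟨ cong (λ z → zeroSlacks σ b + suc z + sign σ) (zeroSlacks-closing w a a-from-w) ⟩
      zeroSlacks σ b + 1 + sign σ                             ≡⟨ cong (_+ sign σ) (+-comm (zeroSlacks σ b) 1) ⟩
      suc (zeroSlacks σ b + sign σ)                           ≡⟨ cong (λ z → suc (zeroSlacks z b + sign z)) σ≡ ⟩
      suc (zeroSlacks (residue c) b + sign (residue c)) ∎
      where open ≡-Reasoning
    corner : corners (b ++ E ∷ a ++ [ N ]) ≡ (corners a + sign c) + corners b
    corner = begin
      corners (b ++ E ∷ a ++ [ N ])                  ≡⟨ corners-++E b (a ++ [ N ]) ⟩
      corners b + endsNorth b + corners (a ++ [ N ]) ≡⟨ cong₂ (λ x y → corners b + x + y) (endsNorth-sign {c} {b} vb) (corners-∷ʳN a) ⟩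
      corners b + sign c + corners a                 ≡⟨ cong (_+ corners a) (+-comm (corners b) (sign c)) ⟩
      sign c + corners b + corners a                 ≡⟨ +-assoc (sign c) (corners b) (corners a) ⟩
      sign c + (corners b + corners a)               ≡⟨ cong (sign c +_) (+-comm (corners b) (corners a)) ⟩
      sign c + (corners a + corners b)               ≡⟨ +-assoc (sign c) (corners a) (corners b) ⟨
      sign c + corners a + corners b                 ≡⟨ cong (_+ corners b) (+-comm (sign c) (corners a)) ⟩
      corners a + sign c + corners b ∎
      where open ≡-Reasoning
    high : maxList (slacks σ (b ++ E ∷ a ++ [ N ])) ≡ suc (maxList (slacks (residue q) a)) ⊔ maxList (slacks (residue c) b)
    high = trans (slacks-++ σ b (E ∷ a ++ [ N ]) b-from-σ)
             (trans (cong₂ _⊔_ (cong (λ z → maxList (slacks z b)) σ≡)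
                               (trans (maxSlack-closing w a a-from-w) (cong (λ z → suc (maxList (slacks z a))) (sym (residue-blockEnd q e)))))
                    (⊔-comm (maxList (slacks (residue c) b)) _))

  pathStats-closing : {q : ℕ} {a : List Step} → blockEnd q ≡ false → SlackPath q a →
    pathStats (suc (q + 0)) (a ++ [ N ]) ≡ joinStats q 0 (pathStats q a) (pathStats 0 [])
  pathStats-closing {q} {a} e (ra , _) = cong₂ _,_ touch (cong₂ _,_ corner high)
    where
    σ = residue (suc (q + 0))
    σ≡ : σ ≡ suc (residue q)
    σ≡ = trans (cong (λ z → residue (suc z)) (+-identityʳ q)) (residue-suc q e)
    touch : zeroSlacks σ (a ++ [ N ]) + sign σ ≡ 1
    touch = trans (cong (λ z → zeroSlacks z (a ++ [ N ]) + sign z) σ≡) (cong (_+ 1) (zeroSlacks-closing (residue q) a ra))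
    corner : corners (a ++ [ N ]) ≡ (corners a + 0) + 0
    corner = trans (corners-∷ʳN a) (sym (trans (+-identityʳ _) (+-identityʳ _)))
    high : maxList (slacks σ (a ++ [ N ])) ≡ suc (maxList (slacks (residue q) a)) ⊔ 0
    high = trans (cong (λ z → maxList (slacks z (a ++ [ N ]))) σ≡) (maxSlack-closing (residue q) a ra)

  pathStats-join : (q c : ℕ) {a b : List Step} → admissible (q , c) ≡ true → SlackPath q a → SlackPath c b →
    pathStats (suc (q + c)) (joinPath q c a b) ≡ joinStats q c (pathStats q a) (pathStats c b)
  pathStats-join q c {a} {b} ok va vb with blockEnd q in e
  ... | true = pathStats-returning {q} {c} {a} {b} e va vb
  ... | false with ≡ᵇ-sound {c} {0} ok
  ... | refl with SlackPath-zero {b} vb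
  ... | refl = pathStats-closing {q} {a} e va

  lastZeroSplit : (σ : ℕ) (s : List Step) {τ : ℕ} → slackRun σ s ≡ just τ →
    zeroSlacks σ s ≡ 0 ⊎ (∃ λ b → ∃ λ t → s ≡ b ++ t × slackRun σ b ≡ just 0 × zeroSlacks 0 t ≡ 1)
  lastZeroSplit σ [] p = inj₁ refl
  lastZeroSplit σ (E ∷ s) p with lastZeroSplit (σ + v) s p
  ... | inj₂ (b , t , refl , rb , tt) = inj₂ (E ∷ b , t , refl , rb , tt)
  lastZeroSplit zero (E ∷ s) p | inj₁ z = inj₂ ([] , E ∷ s , refl , refl , cong suc z)
  lastZeroSplit (suc σ) (E ∷ s) p | inj₁ z = inj₁ z
  lastZeroSplit (suc σ) (N ∷ s) p with lastZeroSplit σ s p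
  ... | inj₂ (b , t , refl , rb , tt) = inj₂ (N ∷ b , t , refl , rb , tt)
  ... | inj₁ z = inj₁ z

  lastNorth : (σ : ℕ) (s : List Step) → slackRun σ s ≡ just 0 → s ≢ [] →
    ∃ λ a → s ≡ a ++ [ N ] × slackRun σ a ≡ just 1
  lastNorth σ s r ne with snocView s ne
  ... | a , x , refl with slackRun-++⁻ σ a [ x ] r
  ... | σ' , ra with x
  ... | E = ⊥-elim (0≢1+n (trans (sym (just-injective (trans (sym (slackRun-++ σ a [ E ] ra)) r))) (+-suc σ' w)))
  ... | N with σ'
  ...   | zero = ⊥-elim (nothing≢just (trans (sym (slackRun-++ σ a [ N ] ra)) r))
    where nothing≢just : ∀ {k} → nothing ≡ just k → ⊥
          nothing≢just ()
  ...   | suc zero = a , refl , ra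
  ...   | suc (suc k) = ⊥-elim (0≢1+n (sym (just-injective (trans (sym (slackRun-++ σ a [ N ] ra)) r))))

  zeroSlacks-prefix : (σ : ℕ) (a t : List Step) {σ' : ℕ} → slackRun σ a ≡ just σ' → zeroSlacks σ (a ++ t) ≡ 0 → zeroSlacks σ a ≡ 0
  zeroSlacks-prefix σ a t r z = m+n≡0⇒m≡0 (zeroSlacks σ a) (trans (sym (zeroSlacks-++ σ a t r)) z)

  prime-path : (t : List Step) → slackRun 0 t ≡ just 0 → zeroSlacks 0 t ≡ 1 → ∃ λ a → t ≡ E ∷ a ++ [ N ] × slackRun w a ≡ just 0
  prime-path [] r ()
  prime-path (N ∷ t) () z
  prime-path (E ∷ t') r z = a , cong (E ∷_) ta , slackRun-pred w a ra (zeroSlacks-prefix v a [ N ] ra (subst (λ u → zeroSlacks v u ≡ 0) ta tz'))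
    where
    tz' : zeroSlacks v t' ≡ 0
    tz' = suc-injective z
    ne : t' ≢ []
    ne e = 0≢1+n (sym (just-injective (trans (sym (cong (slackRun v) e)) r)))
    ln = lastNorth v t' r ne
    a = proj₁ ln
    ta : t' ≡ a ++ [ N ]
    ta = proj₁ (proj₂ ln)
    ra : slackRun v a ≡ just 1
    ra = proj₂ (proj₂ ln)

  zeroSlacks-start : (s : List Step) → s ≢ [] → 1 ≤ zeroSlacks 0 s
  zeroSlacks-start [] ne = ⊥-elim (ne refl)
  zeroSlacks-start (E ∷ s) _ = s≤s z≤n
  zeroSlacks-start (N ∷ s) _ = s≤s z≤n

  blockEnd-norths : (a : List Step) → slackRun w a ≡ just 0 → blockEnd (norths a) ≡ true
  blockEnd-norths a r = cong (_≡ᵇ 0) (begin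
    residue (suc (norths a))         ≡⟨ cong (λ z → residue (suc z)) (slackRun-conservation w a r) ⟩
    residue (v + easts a * v)        ≡⟨ cong residue (*-comm (suc (easts a)) v) ⟩
    residue (v * suc (easts a))      ≡⟨ residue-multiple (suc (easts a)) ⟩
    0 ∎)
    where open ≡-Reasoning

  Decomposition : ℕ → List Step → Set
  Decomposition n s = ∃ λ q → ∃ λ c → ∃₂ λ a b →
    q + c ≡ n × admissible (q , c) ≡ true × SlackPath q a × SlackPath c b × s ≡ joinPath q c a b

  returning-decomposition : (n : ℕ) {b t : List Step} → norths (b ++ t) ≡ suc n →
    slackRun (residue (suc n)) b ≡ just 0 → slackRun 0 t ≡ just 0 → zeroSlacks 0 t ≡ 1 → Decomposition n (b ++ t)
  returning-decomposition n {b} {t} ns rb rt z with prime-path t rt z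
  ... | a , refl , ra = norths a , norths b , a , b , q+c≡n , admissible⁺ (norths a) (norths b) (inj₁ end) , va , vb ,
                        sym (joinPath-returning≡ (norths a) (norths b) a b end)
    where
    end : blockEnd (norths a) ≡ true
    end = blockEnd-norths a ra
    q+c≡n : norths a + norths b ≡ n
    q+c≡n = suc-injective (trans (sym (norths-returning a b)) ns)
    va : SlackPath (norths a) a
    va = subst (λ σ → slackRun σ a ≡ just 0) (sym (residue-blockEnd (norths a) end)) ra , refl
    vb : SlackPath (norths b) b
    vb = subst (λ σ → slackRun σ b ≡ just 0)
           (trans (cong (λ z → residue (suc z)) (sym q+c≡n)) (residue-after-blockEnd (norths a) (norths b) end)) rb , refl

  closing-decomposition : (n σ : ℕ) (s : List Step) → residue (suc n) ≡ σ → slackRun σ s ≡ just 0 → norths s ≡ suc n →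
    zeroSlacks σ s ≡ 0 → Decomposition n s
  closing-decomposition n zero s _ _ ns z =
    ⊥-elim (n≮0 (subst (1 ≤_) z (zeroSlacks-start s (λ e → 0≢1+n (trans (cong norths (sym e)) ns)))))
  closing-decomposition n (suc σ) s eσ r ns z with lastNorth (suc σ) s r (λ e → 0≢1+n (trans (cong norths (sym e)) ns))
  ... | a , refl , ra1 = norths a , 0 , a , [] , trans (+-identityʳ (norths a)) q≡n , admissible⁺ (norths a) 0 (inj₂ refl) , va , (refl , refl) ,
                         sym (joinPath-closing≡ (norths a) 0 a [] notEnd)
    where
    q≡n : norths a ≡ n
    q≡n = suc-injective (trans (sym (norths-closing a)) ns)
    residue-after : residue (suc (norths a)) ≡ suc σ
    residue-after = trans (cong (λ z → residue (suc z)) q≡n) eσ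
    notEnd : blockEnd (norths a) ≡ false
    notEnd = cong (_≡ᵇ 0) residue-after
    va : SlackPath (norths a) a
    va = subst (λ z → slackRun z a ≡ just 0) (sym (residueStep≡suc residue-after))
               (slackRun-pred σ a ra1 (zeroSlacks-prefix (suc σ) a [ N ] ra1 z)) , refl

  path-decomposition : (n : ℕ) {s : List Step} → SlackPath (suc n) s → Decomposition n s
  path-decomposition n {s} (r , ns) with lastZeroSplit (residue (suc n)) s r
  ... | inj₁ z = closing-decomposition n _ s refl r ns z
  ... | inj₂ (b , t , refl , rb , z) = returning-decomposition n {b} {t} ns rb (trans (sym (slackRun-++ (residue (suc n)) b t rb)) r) z

  paths-complete : (f L : ℕ) → L < f → (s : List Step) → SlackPath L s → s ∈ paths f L
  paths-complete (suc f) zero _ s vs = subst (_∈ paths (suc f) zero) (sym (SlackPath-zero {s} vs)) (here refl)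
  paths-complete (suc f) (suc n) (s≤s L≤f) s vs with path-decomposition n {s} vs
  ... | q , c , a , b , refl , ok , va , vb , refl =
    ∈-generate⁺ joinPath [] {f} {q + c} (∈-admissibleSplits⁺ refl ok)
      (paths-complete f q (<-≤-trans (s≤s (m≤m+n q c)) L≤f) a va)
      (paths-complete f c (<-≤-trans (s≤s (m≤n+m c q)) L≤f) b vb)

  zeroSlacks-loop : (b t : List Step) → b ≢ [] → slackRun 0 b ≡ just 0 → zeroSlacks 0 t ≡ 1 → zeroSlacks 0 (b ++ t) ≢ 1
  zeroSlacks-loop b t ne rb tt eq = <-irrefl (sym eq)
    (subst (2 ≤_) (sym (zeroSlacks-++ 0 b t rb)) (subst (λ z → 2 ≤ zeroSlacks 0 b + z) (sym tt) (+-monoˡ-≤ 1 (zeroSlacks-start b ne))))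

  -- The returning part b is recovered as the prefix ending at the last visit to slack 0.
  zeroSplit-unique : (σ : ℕ) (b b' t t' : List Step) → slackRun σ b ≡ just 0 → slackRun σ b' ≡ just 0 →
    zeroSlacks 0 t ≡ 1 → zeroSlacks 0 t' ≡ 1 → b ++ t ≡ b' ++ t' → b ≡ b'
  zeroSplit-unique σ [] [] t t' _ _ _ _ _ = refl
  zeroSplit-unique σ [] (x ∷ b') t t' rb rb' tt tt' refl with just-injective rb
  ... | refl = ⊥-elim (zeroSlacks-loop (x ∷ b') t' (λ ()) rb' tt' tt)
  zeroSplit-unique σ (x ∷ b) [] t t' rb rb' tt tt' refl with just-injective rb'
  ... | refl = ⊥-elim (zeroSlacks-loop (x ∷ b) t (λ ()) rb tt tt')
  zeroSplit-unique σ (E ∷ b) (E ∷ b') t t' rb rb' tt tt' e =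
    cong (E ∷_) (zeroSplit-unique (σ + v) b b' t t' rb rb' tt tt' (proj₂ (∷-injective e)))
  zeroSplit-unique (suc σ) (N ∷ b) (N ∷ b') t t' rb rb' tt tt' e =
    cong (N ∷_) (zeroSplit-unique σ b b' t t' rb rb' tt tt' (proj₂ (∷-injective e)))
  zeroSplit-unique σ (E ∷ b) (N ∷ b') t t' rb rb' tt tt' ()
  zeroSplit-unique σ (N ∷ b) (E ∷ b') t t' rb rb' tt tt' ()

  returning-parts : {q c : ℕ} {a b : List Step} → blockEnd q ≡ true → SlackPath q a → SlackPath c b →
    (slackRun (residue (suc (q + c))) b ≡ just 0) × zeroSlacks 0 (E ∷ a ++ [ N ]) ≡ 1
  returning-parts {q} {c} {a} {b} e (ra , _) (rb , _) =
    subst (λ z → slackRun z b ≡ just 0) (sym (residue-after-blockEnd q c e)) rb ,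
    cong suc (zeroSlacks-closing w a (subst (λ z → slackRun z a ≡ just 0) (residue-blockEnd q e) ra))

  returning-injective : {q c q' c' : ℕ} {a b a' b' : List Step} → q + c ≡ q' + c' → blockEnd q ≡ true → blockEnd q' ≡ true →
    SlackPath q a → SlackPath c b → SlackPath q' a' → SlackPath c' b' →
    b ++ E ∷ a ++ [ N ] ≡ b' ++ E ∷ a' ++ [ N ] → a ≡ a' × b ≡ b'
  returning-injective {q} {c} {q'} {c'} {a} {b} {a'} {b'} size e e' va vb va' vb' eq = a≡a' , b≡b'
    where
    parts = returning-parts {q} {c} {a} {b} e va vb
    parts' = returning-parts {q'} {c'} {a'} {b'} e' va' vb'
    b≡b' : b ≡ b'
    b≡b' = zeroSplit-unique _ b b' _ _ (proj₁ parts)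
             (subst (λ z → slackRun (residue (suc z)) b' ≡ just 0) (sym size) (proj₁ parts')) (proj₂ parts) (proj₂ parts') eq
    a≡a' : a ≡ a'
    a≡a' = ∷ʳ-injectiveˡ a a' (proj₂ (∷-injective (++-cancelˡ b (E ∷ a ++ [ N ]) (E ∷ a' ++ [ N ])
             (trans eq (cong (_++ E ∷ a' ++ [ N ]) (sym b≡b'))))))

  -- A returning path visits slack 0 after its start; a closing one does not.
  returning≢closing : {q c q' : ℕ} {a b a' : List Step} → q + c ≡ q' + 0 → blockEnd q ≡ true → blockEnd q' ≡ false →
    SlackPath q a → SlackPath c b → SlackPath q' a' → b ++ E ∷ a ++ [ N ] ≢ a' ++ [ N ]
  returning≢closing {q} {c} {q'} {a} {b} {a'} size e e' va vb va' eq =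
    0≢1+n (trans (sym closingZeros) (trans (cong (zeroSlacks σ) (sym eq)) returningZeros))
    where
    σ = residue (suc (q + c))
    parts = returning-parts {q} {c} {a} {b} e va vb
    returningZeros : zeroSlacks σ (b ++ E ∷ a ++ [ N ]) ≡ suc (zeroSlacks σ b)
    returningZeros = trans (zeroSlacks-++ σ b (E ∷ a ++ [ N ]) (proj₁ parts))
                           (trans (cong (zeroSlacks σ b +_) (proj₂ parts)) (+-comm (zeroSlacks σ b) 1))
    σ≡ : σ ≡ suc (residue q')
    σ≡ = trans (cong (λ z → residue (suc z)) (trans size (+-identityʳ q'))) (residue-suc q' e')
    closingZeros : zeroSlacks σ (a' ++ [ N ]) ≡ 0
    closingZeros = trans (cong (λ z → zeroSlacks z (a' ++ [ N ])) σ≡) (zeroSlacks-closing (residue q') a' (proj₁ va'))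

  joinPath-injective : {n q c q' c' : ℕ} {a b a' b' : List Step} → (q , c) ∈ admissibleSplits n → (q' , c') ∈ admissibleSplits n →
    SlackPath q a → SlackPath c b → SlackPath q' a' → SlackPath c' b' → joinPath q c a b ≡ joinPath q' c' a' b' →
    (q , c) ≡ (q' , c') × a ≡ a' × b ≡ b'
  joinPath-injective {n} {q} {c} {q'} {c'} {a} {b} {a'} {b'} m m' va vb va' vb' eq
    with ∈-admissibleSplits⁻ {n} {q} {c} m | ∈-admissibleSplits⁻ {n} {q'} {c'} m' | blockEnd q in e | blockEnd q' in e'
  ... | qc , _ | qc' , _ | true | true
    with returning-injective {q} {c} {q'} {c'} {a} {b} {a'} {b'} (trans qc (sym qc')) e e' va vb va' vb' eq
  ...   | refl , refl = cong₂ _,_ (trans (sym (proj₂ va)) (proj₂ va')) (trans (sym (proj₂ vb)) (proj₂ vb')) , refl , refl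
  joinPath-injective {n} {q} {c} {q'} {c'} {a} {b} {a'} {b'} m m' va vb va' vb' eq | qc , _ | qc' , ok' | true | false
    with admissible-notBlockEnd q' c' e' ok'
  ...   | refl = ⊥-elim (returning≢closing {q} {c} {q'} {a} {b} {a'} (trans qc (sym qc')) e e' va vb va' eq)
  joinPath-injective {n} {q} {c} {q'} {c'} {a} {b} {a'} {b'} m m' va vb va' vb' eq | qc , ok | qc' , _ | false | true
    with admissible-notBlockEnd q c e ok
  ...   | refl = ⊥-elim (returning≢closing {q'} {c'} {q} {a'} {b'} {a} (trans qc' (sym qc)) e' e va' vb' va (sym eq))
  joinPath-injective {n} {q} {c} {q'} {c'} {a} {b} {a'} {b'} m m' va vb va' vb' eq | qc , ok | qc' , ok' | false | false
    with admissible-notBlockEnd q c e ok | admissible-notBlockEnd q' c' e' ok'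
  ...   | refl | refl with SlackPath-zero {b} vb | SlackPath-zero {b'} vb'
                           | ∷ʳ-injectiveˡ a a' eq
  ...   | refl | refl | refl = cong₂ _,_ (trans (sym (proj₂ va)) (proj₂ va')) refl , refl , refl

  below-east : (x y : ℕ) → y ≤ v * x → y ≤ v * suc x
  below-east x y p = ≤-trans p (*-monoʳ-≤ v (n≤1+n x))

  slack-east : (x y : ℕ) {σ : ℕ} → y ≤ v * x → σ ≡ v * x ∸ y → σ + v ≡ v * suc x ∸ y
  slack-east x y p e = trans (cong (_+ v) e) (sym (trans (cong (_∸ y) (*-suc v x)) (trans (+-∸-assoc v p) (+-comm v _))))

  below-north : (x y : ℕ) {σ : ℕ} → suc σ ≡ v * x ∸ y → suc y ≤ v * x
  below-north x y e = m∸n≢0⇒n<m (λ z → 0≢1+n (trans (sym z) (sym e)))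

  slack-north : (x y : ℕ) {σ : ℕ} → suc σ ≡ v * x ∸ y → σ ≡ v * x ∸ suc y
  slack-north x y e = trans (cong pred e) (pred[m∸n]≡m∸[1+n] (v * x) y)

  -- Defs states its point conditions with pattern lambdas, so they enter here through g and the equation hg.
  module _ (g : ℕ × ℕ → Bool) (hg : ∀ x y → g (x , y) ≡ (y ≡ᵇ v * x)) where

    onLine-zeroSlack : (x y : ℕ) {σ : ℕ} → y ≤ v * x → σ ≡ v * x ∸ y → (if g (x , y) then 1 else 0) ≡ isZero σ
    onLine-zeroSlack x y p e = cong (λ b → if b then 1 else 0) (trans (hg x y) (trans (≡ᵇ-slack y (v * x) p) (cong (_≡ᵇ 0) (sym e))))

    count-onLine≡zeroSlacks : (s : List Step) (σ x y : ℕ) {τ : ℕ} → y ≤ v * x → σ ≡ v * x ∸ y → slackRun σ s ≡ just τ →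
      countᵇ g (pointsBefore (x , y) s) ≡ zeroSlacks σ s
    count-onLine≡zeroSlacks [] σ x y p e r = refl
    count-onLine≡zeroSlacks (E ∷ s) σ x y p e r =
      cong₂ _+_ (onLine-zeroSlack x y p e) (count-onLine≡zeroSlacks s (σ + v) (suc x) y (below-east x y p) (slack-east x y p e) r)
    count-onLine≡zeroSlacks (N ∷ s) (suc σ) x y p e r =
      cong₂ _+_ (onLine-zeroSlack x y p e) (count-onLine≡zeroSlacks s σ x (suc y) (below-north x y e) (slack-north x y e) r)

  module _ (h : ℕ × ℕ → ℕ) (hh : ∀ x y → h (x , y) ≡ v * x ∸ y) where

    map-slack≡slacks : (s : List Step) (σ x y : ℕ) {τ : ℕ} → y ≤ v * x → σ ≡ v * x ∸ y → slackRun σ s ≡ just τ →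
      map h (pointsBefore (x , y) s) ++ [ h (endPoint (x , y) s) ] ≡ slacks σ s
    map-slack≡slacks [] σ x y p e r = cong [_] (trans (hh x y) (sym e))
    map-slack≡slacks (E ∷ s) σ x y p e r =
      cong₂ _∷_ (trans (hh x y) (sym e)) (map-slack≡slacks s (σ + v) (suc x) y (below-east x y p) (slack-east x y p e) r)
    map-slack≡slacks (N ∷ s) (suc σ) x y p e r =
      cong₂ _∷_ (trans (hh x y) (sym e)) (map-slack≡slacks s σ x (suc y) (below-north x y e) (slack-north x y e) r)

  module _ (g : ℕ × ℕ → Bool) (hg : ∀ x y → g (x , y) ≡ (y ≤ᵇ v * x)) where

    slackRun⇒below : (s : List Step) (σ x y : ℕ) {τ : ℕ} → y ≤ v * x → σ ≡ v * x ∸ y → slackRun σ s ≡ just τ →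
      allᵇ g (pointsBefore (x , y) s ++ [ endPoint (x , y) s ]) ≡ true
    slackRun⇒below [] σ x y p e r = cong (_∧ true) (trans (hg x y) (≤ᵇ-true p))
    slackRun⇒below (E ∷ s) σ x y p e r =
      ∧-intro (trans (hg x y) (≤ᵇ-true p)) (slackRun⇒below s (σ + v) (suc x) y (below-east x y p) (slack-east x y p e) r)
    slackRun⇒below (N ∷ s) (suc σ) x y p e r =
      ∧-intro (trans (hg x y) (≤ᵇ-true p)) (slackRun⇒below s σ x (suc y) (below-north x y e) (slack-north x y e) r)

    below-head : (s : List Step) (x y : ℕ) → allᵇ g (pointsBefore (x , y) s ++ [ endPoint (x , y) s ]) ≡ true → y ≤ v * x
    below-head [] x y a = ≤ᵇ-sound (trans (sym (hg x y)) (proj₁ (∧-true a)))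
    below-head (E ∷ s) x y a = ≤ᵇ-sound (trans (sym (hg x y)) (proj₁ (∧-true a)))
    below-head (N ∷ s) x y a = ≤ᵇ-sound (trans (sym (hg x y)) (proj₁ (∧-true a)))

    below⇒slackRun : (s : List Step) (σ x y : ℕ) → σ ≡ v * x ∸ y →
      allᵇ g (pointsBefore (x , y) s ++ [ endPoint (x , y) s ]) ≡ true → ∃ λ τ → slackRun σ s ≡ just τ
    below⇒slackRun [] σ x y e a = σ , refl
    below⇒slackRun (E ∷ s) σ x y e a = below⇒slackRun s (σ + v) (suc x) y (slack-east x y (below-head (E ∷ s) x y a) e) (proj₂ (∧-true a))
    below⇒slackRun (N ∷ s) zero x y e a = ⊥-elim (<-irrefl e (m<n⇒0<n∸m (below-head s x (suc y) (proj₂ (∧-true a)))))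
    below⇒slackRun (N ∷ s) (suc σ) x y e a = below⇒slackRun s σ x (suc y) (slack-north x y e) (proj₂ (∧-true a))

  blockEnd-small : (i : ℕ) → suc i ≤ w → blockEnd i ≡ false
  blockEnd-small i p = cong (_≡ᵇ 0) (residue-small (suc i) p)

  blockIncr-inBlock : (i : ℕ) (B : List ℕ) → i + length B ≤ v → blockIncr i B ≡ increasing B
  blockIncr-inBlock i [] p = refl
  blockIncr-inBlock i (x ∷ []) p = refl
  blockIncr-inBlock i (x ∷ y ∷ B) p =
    cong₂ _∧_ (cong (_∨ (x <ᵇ y)) (blockEnd-small i inside)) (blockIncr-inBlock (suc i) (y ∷ B) (subst (_≤ v) (+-suc i (suc (length B))) p))
    where
    inside : suc i ≤ w
    inside = ≤-pred (≤-trans (s≤s (s≤s (m≤m+n i (length B))))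
                       (subst (_≤ v) (trans (+-suc i (suc (length B))) (cong suc (+-suc i (length B)))) p))

  blockIncr-++ : (i : ℕ) (x : ℕ) (B R : List ℕ) → i + length (x ∷ B) ≡ v →
    blockIncr i ((x ∷ B) ++ R) ≡ (blockIncr i (x ∷ B) ∧ blockIncr 0 R)
  blockIncr-++ i x [] [] e = refl
  blockIncr-++ i x [] (y ∷ R) e =
    cong₂ _∧_ (cong (_∨ (x <ᵇ y)) end)
              (trans (cong (λ z → blockIncr z (y ∷ R)) (trans i+1≡v (sym (+-identityʳ v)))) (blockIncr-shiftBlocks v 0 (y ∷ R) residue-v))
    where
    i+1≡v : suc i ≡ v
    i+1≡v = trans (+-comm 1 i) e
    end : blockEnd i ≡ true
    end = cong (_≡ᵇ 0) (trans (cong residue i+1≡v) residue-v)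
  blockIncr-++ i x (x' ∷ B) R e =
    trans (cong ((blockEnd i ∨ (x <ᵇ x')) ∧_) (blockIncr-++ (suc i) x' B R (trans (sym (+-suc i (suc (length B)))) e)))
          (sym (∧-assoc (blockEnd i ∨ (x <ᵇ x')) _ _))

  diamondOK≡blockIncr : 2 ≤ w → (B : List ℕ) → length B ≡ v → avoids132 B ≡ true → Unique B → diamondOK B ≡ blockIncr 0 B
  diamondOK≡blockIncr h (l ∷ rest) lenB av u with snocView rest (λ e → n≮0 (subst (2 ≤_) (trans (sym (suc-injective lenB)) (cong length e)) h))
  ... | ms , g , refl =
    trans (diamondOK≡increasing l ms g middles av u) (sym (blockIncr-inBlock 0 (l ∷ ms ++ [ g ]) (≤-reflexive lenB)))
    where
    middles : ms ≢ []
    middles e = <-irrefl refl (subst (2 ≤_) (trans (sym (suc-injective lenB)) (cong (λ z → length (z ++ [ g ])) e)) h)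

  diamondsOK≡blockIncr : 2 ≤ w → (d : ℕ) (π : List ℕ) → length π ≡ v * d → Unique π → avoids132 π ≡ true →
    diamondsOK v d π ≡ blockIncr 0 π
  diamondsOK≡blockIncr h zero [] len u av = refl
  diamondsOK≡blockIncr h zero (x ∷ π) len u av = ⊥-elim (0≢1+n (trans (sym (*-zeroʳ v)) (sym len)))
  diamondsOK≡blockIncr h (suc d) π len u av = begin
    diamondOK B ∧ diamondsOK v d R   ≡⟨ cong₂ _∧_ (diamondOK≡blockIncr h B lenB (avoids-prefix B R av') (unique-++⁻ˡ B u'))
                                                   (diamondsOK≡blockIncr h d R lenR (unique-++⁻ʳ B u') (avoids-suffix B R av')) ⟩
    blockIncr 0 B ∧ blockIncr 0 R    ≡⟨ split B lenB ⟨
    blockIncr 0 (B ++ R)             ≡⟨ cong (blockIncr 0) (take++drop≡id v π) ⟩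
    blockIncr 0 π ∎
    where
    open ≡-Reasoning
    B = take v π
    R = drop v π
    lenπ : length π ≡ v + v * d
    lenπ = trans len (*-suc v d)
    lenB : length B ≡ v
    lenB = trans (length-take v π) (m≤n⇒m⊓n≡m (subst (v ≤_) (sym lenπ) (m≤m+n v (v * d))))
    lenR : length R ≡ v * d
    lenR = trans (length-drop v π) (trans (cong (_∸ v) lenπ) (m+n∸m≡n v (v * d)))
    u' : Unique (B ++ R)
    u' = subst Unique (sym (take++drop≡id v π)) u
    av' : avoids132 (B ++ R) ≡ true
    av' = subst (λ z → avoids132 z ≡ true) (sym (take++drop≡id v π)) av
    split : (B : List ℕ) → length B ≡ v → blockIncr 0 (B ++ R) ≡ (blockIncr 0 B ∧ blockIncr 0 R)
    split (x ∷ B') e = blockIncr-++ 0 x B' R e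

  perms-unique : (f L : ℕ) → Unique (perms f L)
  perms-unique = generate-unique joinPerm [] BlockPerm (λ {f} {L} → perms-sound {f} {L})
    (λ {n} m m' (pa , _) (pb , _) (pa' , _) (pb' , _) →
      joinPerm-injective (proj₁ (∈-admissibleSplits⁻ {n} m)) (proj₁ (∈-admissibleSplits⁻ {n} m')) pa pb pa' pb')

  paths-unique : (f L : ℕ) → Unique (paths f L)
  paths-unique = generate-unique joinPath [] SlackPath (λ {f} {L} → paths-sound {f} {L})
    (λ {n} m m' → joinPath-injective {n} m m')

  perms-paths-stats : (f L : ℕ) → map (permStats L) (perms f L) ≡ map (pathStats L) (paths f L)
  perms-paths-stats = generate-stats joinPerm [] joinPath [] permStats pathStats joinStats refl
    (λ {f} {n} {q} {c} {a} {b} → permStep {f} {n} {q} {c} {a} {b}) (λ {f} {n} {q} {c} {a} {b} → pathStep {f} {n} {q} {c} {a} {b})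
    where
    permStep : ∀ {f n q c a b} → (q , c) ∈ admissibleSplits n → a ∈ perms f q → b ∈ perms f c →
      permStats (suc n) (joinPerm q c a b) ≡ joinStats q c (permStats q a) (permStats c b)
    permStep {f} {n} {q} {c} {a} {b} m a∈ b∈ with ∈-admissibleSplits⁻ {n} {q} {c} m
    ... | refl , _ = permStats-join q c {a} {b} (proj₁ (perms-sound {f} {q} a∈)) (proj₁ (perms-sound {f} {c} b∈))
    pathStep : ∀ {f n q c a b} → (q , c) ∈ admissibleSplits n → a ∈ paths f q → b ∈ paths f c →
      pathStats (suc n) (joinPath q c a b) ≡ joinStats q c (pathStats q a) (pathStats c b)
    pathStep {f} {n} {q} {c} {a} {b} m a∈ b∈ with ∈-admissibleSplits⁻ {n} {q} {c} m
    ... | refl , ok = pathStats-join q c {a} {b} ok (paths-sound {f} {q} a∈) (paths-sound {f} {c} b∈)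

  labels-↭ : (L : ℕ) {π : List ℕ} → π ∈ permutations (labels L) → π ↭ interval 0 L
  labels-↭ L m = subst (_ ↭_) (labels≡interval L) (∈-permutations⁻ (labels L) m)

  ↭-labels : (L : ℕ) {π : List ℕ} → π ↭ interval 0 L → π ∈ permutations (labels L)
  ↭-labels L p = ∈-permutations⁺ (labels L) (subst (_ ↭_) (sym (labels≡interval L)) p)

  diamonds132↭perms : 2 ≤ w → (d : ℕ) → diamonds132 v d ↭ perms (suc (v * d)) (v * d)
  diamonds132↭perms h d = unique-sameElements⇒↭
    (Uniqueₚ.filter⁺ (T? ∘ isDiamond) (permutations-unique (labels L) (subst Unique (sym (labels≡interval L)) (interval-unique 0 L))))
    (perms-unique (suc L) L) to from
    where
    L = v * d
    isDiamond = λ π → diamondsOK v d π ∧ avoids132 π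
    blocks : {π : List ℕ} → π ↭ interval 0 L → avoids132 π ≡ true → diamondsOK v d π ≡ blockIncr 0 π
    blocks p av = diamondsOK≡blockIncr h d _ (length-↭interval p) (unique-resp-↭ (↭-sym p) (interval-unique 0 L)) av
    to : ∀ {π} → π ∈ diamonds132 v d → π ∈ perms (suc L) L
    to {π} m with ∈-filter⁻ (T? ∘ isDiamond) m
    ... | m' , t with ∧-true (Equivalence.to T-≡ t)
    ... | ok , av = perms-complete (suc L) L ≤-refl π (labels-↭ L m' , trans (sym (blocks (labels-↭ L m') av)) ok , av)
    from : ∀ {π} → π ∈ perms (suc L) L → π ∈ diamonds132 v d
    from {π} m with perms-sound {suc L} {L} m
    ... | p , bi , av = ∈-filter⁺ (T? ∘ isDiamond) (↭-labels L p) (Equivalence.from T-≡ (∧-intro (trans (blocks p av) bi) av))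

  slack-origin : 0 ≡ v * 0 ∸ 0
  slack-origin = sym (*-zeroʳ v)

  slackRun-dyck : (d : ℕ) (s : List Step) → SlackPath (v * d) s → slackRun 0 s ≡ just 0
  slackRun-dyck d s (r , _) = subst (λ σ → slackRun σ s ≡ just 0) (residue-multiple d) r

  paths↭dyckPaths : (d : ℕ) → paths (suc (v * d)) (v * d) ↭ dyckPaths v d
  paths↭dyckPaths d = unique-sameElements⇒↭ (paths-unique (suc L) L) (Uniqueₚ.filter⁺ (T? ∘ weaklyBelow v) (words-unique d L)) to from
    where
    L = v * d
    to : ∀ {s} → s ∈ paths (suc L) L → s ∈ dyckPaths v d
    to {s} m with paths-sound {suc L} {L} m
    ... | vs@(_ , ns) = ∈-filter⁺ (T? ∘ weaklyBelow v) (subst₂ (λ e n → s ∈ words e n) e≡d ns (∈-words⁺ s))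
                          (Equivalence.from T-≡ (slackRun⇒below _ (λ x y → refl) s 0 0 0 z≤n slack-origin (slackRun-dyck d s vs)))
      where
      e≡d : easts s ≡ d
      e≡d = sym (*-cancelʳ-≡ d (easts s) v (trans (*-comm d v) (trans (sym ns) (slackRun-conservation 0 s (slackRun-dyck d s vs)))))
    from : ∀ {s} → s ∈ dyckPaths v d → s ∈ paths (suc L) L
    from {s} m with ∈-filter⁻ (T? ∘ weaklyBelow v) m
    ... | m' , t with ∈-words⁻ d L m' | below⇒slackRun _ (λ x y → refl) s 0 0 0 slack-origin (Equivalence.to T-≡ t)
    ... | e≡d , n≡L | τ , r = paths-complete (suc L) L ≤-refl s (subst (λ σ → slackRun σ s ≡ just 0) (sym (residue-multiple d)) r0 , n≡L)
      where
      τ≡0 : τ ≡ 0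
      τ≡0 = +-cancelʳ-≡ L τ 0 (trans (cong (τ +_) (sym n≡L))
              (trans (slackRun-conservation 0 s r) (trans (cong (_* v) e≡d) (*-comm d v))))
      r0 : slackRun 0 s ≡ just 0
      r0 = trans r (cong just τ≡0)

  monomial : ℕ → Stats → Monomial
  monomial d (a , b , c) = a , b , d , c

  pathStats-dyck : (d : ℕ) (s : List Step) → SlackPath (v * d) s →
    monomial d (pathStats (v * d) s) ≡ (touchpoints v s , corners s , d , height v s)
  pathStats-dyck d s vs = cong₂ _,_ touch (cong (λ h → corners s , d , h) high)
    where
    r0 = slackRun-dyck d s vs
    touch : zeroSlacks (residue (v * d)) s + sign (residue (v * d)) ≡ touchpoints v s
    touch = trans (cong (λ σ → zeroSlacks σ s + sign σ) (residue-multiple d))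
              (trans (+-identityʳ (zeroSlacks 0 s)) (sym (count-onLine≡zeroSlacks _ (λ x y → refl) s 0 0 0 z≤n slack-origin r0)))
    high : maxList (slacks (residue (v * d)) s) ≡ height v s
    high = trans (cong (λ σ → maxList (slacks σ s)) (residue-multiple d))
             (sym (cong maxList (trans (map-++ _ (pointsBefore (0 , 0) s) [ endPoint (0 , 0) s ])
                                        (map-slack≡slacks _ (λ x y → refl) s 0 0 0 z≤n slack-origin r0))))

  diamond-dyck : 2 ≤ w → (d : ℕ) (m : Monomial) → coeff (diamondPoly v d) m ≡ coeff (dyckPoly v d) m
  diamond-dyck h d m = begin
    countᵇ (_≡ᵐ m) (map diamondMonomial (diamonds132 v d))
      ≡⟨ countᵇ-↭ (_≡ᵐ m) (↭-map⁺ diamondMonomial (diamonds132↭perms h d)) ⟩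
    countᵇ (_≡ᵐ m) (map diamondMonomial (perms (suc L) L))
      ≡⟨ cong (countᵇ (_≡ᵐ m)) sameMonomials ⟩
    countᵇ (_≡ᵐ m) (map pathMonomial (paths (suc L) L))
      ≡⟨ countᵇ-↭ (_≡ᵐ m) (↭-map⁺ pathMonomial (paths↭dyckPaths d)) ⟩
    countᵇ (_≡ᵐ m) (map pathMonomial (dyckPaths v d)) ∎
    where
    open ≡-Reasoning
    L = v * d
    diamondMonomial : List ℕ → Monomial
    diamondMonomial π = rlmax π , des π , d , lis π
    pathMonomial : List Step → Monomial
    pathMonomial p = touchpoints v p , corners p , d , height v p
    sameMonomials : map diamondMonomial (perms (suc L) L) ≡ map pathMonomial (paths (suc L) L)
    sameMonomials = begin
      map (monomial d ∘ permStats L) (perms (suc L) L)     ≡⟨ map-∘ (perms (suc L) L) ⟩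
      map (monomial d) (map (permStats L) (perms (suc L) L)) ≡⟨ cong (map (monomial d)) (perms-paths-stats (suc L) L) ⟩
      map (monomial d) (map (pathStats L) (paths (suc L) L)) ≡⟨ map-∘ (paths (suc L) L) ⟨
      map (monomial d ∘ pathStats L) (paths (suc L) L)     ≡⟨ map-cong-local (Allₚ.tabulate (λ {s} s∈ → pathStats-dyck d s (paths-sound {suc L} {L} {s} s∈))) ⟩
      map pathMonomial (paths (suc L) L) ∎

theorem2p5 : (v d : ℕ) → 4 ≤ v → 1 ≤ d →
    (m : Monomial) → coeff (diamondPoly v d) m ≡ coeff (dyckPoly v d) m
theorem2p5 (suc w) d (s≤s 3≤w) _ = diamond-dyck w (≤-trans (n≤1+n 2) 3≤w) d
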